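{- For $n\ge 1$ let $\mathrm{Av}_n(213)$ denote the set of permutations $\pi=\pi_1\cdots\pi_n$ of $[n]=\{1,\dots,n\}$ avoiding the pattern $213$ (i.e. there are no indices $p<q<r$ with $\pi_q<\pi_p<\pi_r$). For a permutation $\pi$ of $[n]$ put $H(\pi)=\sum_{t=1}^{n-1}\min\{\pi_t,\pi_{t+1}\}$, and let $H_n=\sum_{\pi\in\mathrm{Av}_n(213)}H(\pi)$. Then for all $n\ge 1$, \[ H_n=\frac{n}{2}\binom{2n}{n}-4^{\,n-1}. \] Equivalently, the ordinary generating function $H(x)=\sum_{n\ge 1}H_nx^n$ equals $x(1-4x)^{ -3/2}-x(1-4x)^{ -1}$.
   Context: $H(\pi)$ is the number of horizontal edges of the grid graph of $\pi$: the graph with vertex set $\{(i,j):1\le i\le n,\ 1\le j\le \pi_i\}$, where $(i,j),(i',j')$ are adjacent iff either $i=i'$ and $|j-j'|=1$, or $|i-i'|=1$ and $j=j'$. -}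

module Defs where

open import Data.Nat using (ℕ; zero; suc; _+_; _*_; _∸_; _<ᵇ_; _≡ᵇ_; _⊓_)
open import Data.Bool using (Bool; true; false; _∧_; _∨_; not)
open import Data.List using (List; []; _∷_; map; concatMap; filter; length; upTo)
open import Data.Nat.ListAction using (sum)
open import Data.Bool.ListAction using (all; any)
open import Relation.Nullary.Decidable using (yes; no)
open import Relation.Binary.PropositionalEquality using (_≡_)
open import Data.Bool.Properties using (T?)

range1 : ℕ → List ℕ
range1 n = map suc (upTo n)

words : ℕ → ℕ → List (List ℕ)
words k zero    = [] ∷ []
words k (suc m) = concatMap (λ w → map (λ a → a ∷ w) (range1 k)) (words k m)

count : ℕ → List ℕ → ℕ
count v []       = 0
count v (a ∷ w)  with v ≡ᵇ a
... | true  = suc (count v w)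
... | false = count v w

isPerm : ℕ → List ℕ → Bool
isPerm n w = (length w ≡ᵇ n) ∧ all (λ v → count v w ≡ᵇ 1) (range1 n)

has13above : ℕ → List ℕ → Bool
has13above a []      = false
has13above a (b ∷ w) = ((b <ᵇ a) ∧ any (λ c → a <ᵇ c) w) ∨ has13above a w

contains213 : List ℕ → Bool
contains213 []      = false
contains213 (a ∷ w) = has13above a w ∨ contains213 w

avoids213 : List ℕ → Bool
avoids213 w = not (contains213 w)

Av213 : ℕ → List (List ℕ)
Av213 n = filter (λ w → T? (isPerm n w ∧ avoids213 w)) (words n n)

H : List ℕ → ℕ
H []            = 0
H (a ∷ [])      = 0
H (a ∷ b ∷ w)   = (a ⊓ b) + H (b ∷ w)

Hsum : ℕ → ℕ
Hsum n = sum (map H (Av213 n))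

module Submission where

-- Every π ∈ Av_{n+1}(213) factors uniquely as π = (α + k + 1) 1 (β + 1) with α ∈ Av_{n-k}(213) and
-- β ∈ Av_k(213), because an entry before 1 smaller than an entry after it would form a 213; and
-- H(π) = H(α) + H(β) + glueGain k |α|. For the generating functions c of the Catalan numbers |Av_n(213)|
-- and h of the H_n this gives c = 1 + x c² and h = x (2 c h + b θc + θc), where θ = x d/dx and b = c + θc.
-- With s = 1 - 2xc one has b s = 1 and s² = 1 - 4x, hence b² = 1 + 4x b², θb = x (4 θb + 2 b) and
-- 2h = θb - 2x b². Comparing coefficients, (n+1) b_{n+1} = (4n+2) b_n gives b_n = (2n choose n), b² has
-- coefficients 4ⁿ, and so 2 H_{n+1} = (n+1) (2n+2 choose n+1) - 2·4ⁿ.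

module ListSum where

  open import Data.List.Base using (List; []; _∷_; _++_; map; concatMap; length)
  open import Data.List.Membership.Propositional using (_∈_)
  open import Data.List.Properties using (map-++; length-++)
  open import Data.List.Relation.Unary.Any using (here; there)
  open import Data.Nat.Base
  open import Data.Nat.ListAction using (sum)
  open import Data.Nat.ListAction.Properties using (sum-++)
  open import Data.Nat.Properties using (*-zeroʳ; *-distribˡ-+)
  open import Data.Nat.Tactic.RingSolver using (solve-∀)
  open import Function.Base using (_∘_)
  open import Relation.Binary.PropositionalEquality

  module _ {A : Set} where

    sum-map-cong : ∀ {f g : A → ℕ} xs → (∀ {x} → x ∈ xs → f x ≡ g x) → sum (map f xs) ≡ sum (map g xs)
    sum-map-cong []       f≗g = refl
    sum-map-cong (x ∷ xs) f≗g = cong₂ _+_ (f≗g (here refl)) (sum-map-cong xs (f≗g ∘ there))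

    sum-map-+ : ∀ (f g : A → ℕ) xs → sum (map (λ x → f x + g x) xs) ≡ sum (map f xs) + sum (map g xs)
    sum-map-+ f g []       = refl
    sum-map-+ f g (x ∷ xs) =
      trans (cong (f x + g x +_) (sum-map-+ f g xs)) (interchange (f x) (g x) _ _)
      where
      interchange : ∀ a b c d → a + b + (c + d) ≡ a + c + (b + d)
      interchange = solve-∀

    sum-map-*ˡ : ∀ a (f : A → ℕ) xs → sum (map (λ x → a * f x) xs) ≡ a * sum (map f xs)
    sum-map-*ˡ a f []       = sym (*-zeroʳ a)
    sum-map-*ˡ a f (x ∷ xs) = trans (cong (a * f x +_) (sum-map-*ˡ a f xs)) (sym (*-distribˡ-+ a (f x) _))

    sum-map-const : ∀ a (xs : List A) → sum (map (λ _ → a) xs) ≡ length xs * a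
    sum-map-const a []       = refl
    sum-map-const a (x ∷ xs) = cong (a +_) (sum-map-const a xs)

  module _ {A B : Set} where

    sum-map-concatMap : ∀ (g : B → ℕ) (f : A → List B) xs →
                        sum (map g (concatMap f xs)) ≡ sum (map (λ x → sum (map g (f x))) xs)
    sum-map-concatMap g f []       = refl
    sum-map-concatMap g f (x ∷ xs) = begin
      sum (map g (f x ++ concatMap f xs))
        ≡⟨ cong sum (map-++ g (f x) (concatMap f xs)) ⟩
      sum (map g (f x) ++ map g (concatMap f xs))
        ≡⟨ sum-++ (map g (f x)) _ ⟩
      sum (map g (f x)) + sum (map g (concatMap f xs))
        ≡⟨ cong (sum (map g (f x)) +_) (sum-map-concatMap g f xs) ⟩
      sum (map g (f x)) + sum (map (λ x → sum (map g (f x))) xs) ∎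
      where open ≡-Reasoning

    length-concatMap : ∀ (f : A → List B) xs → length (concatMap f xs) ≡ sum (map (λ x → length (f x)) xs)
    length-concatMap f []       = refl
    length-concatMap f (x ∷ xs) = trans (length-++ (f x)) (cong (length (f x) +_) (length-concatMap f xs))

module ListUniqueness where

  import Axiom.UniquenessOfIdentityProofs as UIP
  open import Data.List.Base using (List; []; _∷_; concatMap)
  open import Data.List.Membership.Propositional using (_∈_; find)
  open import Data.List.Membership.Propositional.Properties using (∈-concatMap⁻)
  import Data.List.Membership.Setoid.Properties as SetoidMembership
  open import Data.List.Relation.Binary.BagAndSetEquality using (∼bag⇒↭)
  open import Data.List.Relation.Binary.Permutation.Propositional using (_↭_)
  import Data.List.Relation.Unary.All as All
  import Data.List.Relation.Unary.AllPairs as AllPairs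
  open import Data.List.Relation.Unary.Any using (here; there)
  open import Data.List.Relation.Unary.Unique.Propositional using (Unique)
  import Data.List.Relation.Unary.Unique.Propositional.Properties as Unique
  open import Data.Product.Base using (_×_; _,_)
  open import Function.Base using (_∘_)
  open import Function.Bundles using (Equivalence; _⇔_)
  open import Relation.Binary.Definitions using (DecidableEquality)
  open import Relation.Binary.PropositionalEquality
  open import Relation.Nullary.Negation using (¬_)

  module _ {A B : Set} (f : A → List B) where

    concatMap-unique : ∀ {xs} → Unique xs → (∀ {x} → x ∈ xs → Unique (f x)) →
                       (∀ {x y z} → x ∈ xs → y ∈ xs → z ∈ f x → z ∈ f y → x ≡ y) → Unique (concatMap f xs)
    concatMap-unique {[]}     _                 _        _        = AllPairs.[]
    concatMap-unique {x ∷ xs} (x∉xs AllPairs.∷ xs-unique) f-unique disjoint =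
      Unique.++⁺ (f-unique (here refl))
                 (concatMap-unique xs-unique (f-unique ∘ there) (λ x∈ y∈ → disjoint (there x∈) (there y∈)))
                 apart
      where
      apart : ∀ {z} → ¬ (z ∈ f x × z ∈ concatMap f xs)
      apart (z∈fx , z∈fxs) with y , y∈xs , z∈fy ← find (∈-concatMap⁻ f z∈fxs) =
        All.lookup x∉xs y∈xs (disjoint (here refl) (there y∈xs) z∈fx z∈fy)

  unique-⇔⇒↭ : ∀ {A : Set} → DecidableEquality A → {xs ys : List A} → Unique xs → Unique ys →
               (∀ {z} → z ∈ xs ⇔ z ∈ ys) → xs ↭ ys
  unique-⇔⇒↭ {A} _≟_ xs-unique ys-unique xs⇔ys = ∼bag⇒↭ (record
    { Equivalence xs⇔ys
    ; inverse = (λ _ → ∈-irrelevant ys-unique _ _) , (λ _ → ∈-irrelevant xs-unique _ _) })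
    where
    ∈-irrelevant : ∀ {zs} → Unique zs → ∀ {z} (p q : z ∈ zs) → p ≡ q
    ∈-irrelevant = SetoidMembership.unique⇒irrelevant (setoid A) (UIP.Decidable⇒UIP.≡-irrelevant _≟_)

module AntidiagonalSum where

  open ListSum
  open import Data.List.Base using (map; upTo)
  open import Data.List.Properties using (map-applyUpTo; map-cong)
  open import Data.Nat.Base
  open import Data.Nat.ListAction using (sum)
  open import Data.Nat.Properties using (+-identityʳ)
  open import Relation.Binary.PropositionalEquality

  antidiagonalSum : (ℕ → ℕ → ℕ) → ℕ → ℕ
  antidiagonalSum f n = sum (map (λ k → f k (n ∸ k)) (upTo (suc n)))

  antidiagonalSum-suc : ∀ f n → antidiagonalSum f (suc n) ≡ f 0 (suc n) + antidiagonalSum (λ k → f (suc k)) n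
  antidiagonalSum-suc f n = cong (λ xs → f 0 (suc n) + sum xs)
    (trans (map-applyUpTo suc _ (suc n)) (sym (map-applyUpTo (λ k → k) _ (suc n))))

  antidiagonalSum-cong : ∀ {f g} → (∀ k m → f k m ≡ g k m) → ∀ n → antidiagonalSum f n ≡ antidiagonalSum g n
  antidiagonalSum-cong f≗g n = cong sum (map-cong (λ k → f≗g k (n ∸ k)) (upTo (suc n)))

  antidiagonalSum-+ : ∀ f g n → antidiagonalSum (λ k m → f k m + g k m) n ≡ antidiagonalSum f n + antidiagonalSum g n
  antidiagonalSum-+ f g n = sum-map-+ (λ k → f k (n ∸ k)) (λ k → g k (n ∸ k)) (upTo (suc n))

  atZero : ℕ → ℕ → ℕ
  atZero zero    a = a
  atZero (suc m) a = 0

  antidiagonalSum-atZero : ∀ g n → antidiagonalSum (λ k m → atZero m (g k)) n ≡ g n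
  antidiagonalSum-atZero g zero    = +-identityʳ (g 0)
  antidiagonalSum-atZero g (suc n) =
    trans (antidiagonalSum-suc (λ k m → atZero m (g k)) n) (antidiagonalSum-atZero (λ k → g (suc k)) n)

module Counting where

  open import Data.Bool.Base using (true; false; T)
  open import Data.Empty using (⊥-elim)
  open import Data.List.Base using (List; []; _∷_; _++_; map; length; filter)
  open import Data.List.Membership.Propositional using (_∈_)
  open import Data.List.Properties using (filter-accept; filter-reject; filter-++; length-++)
  open import Data.List.Relation.Unary.All using (All; []; _∷_)
  open import Data.List.Relation.Unary.Any using (here; there)
  open import Data.Nat.Base
  open import Data.Nat.Properties
  open import Defs using (count)
  open import Function.Base using (_∘_)
  open import Relation.Binary.Definitions using (tri<; tri≈; tri>)
  open import Relation.Binary.PropositionalEquality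
  open import Relation.Nullary.Decidable using (yes; no)
  open ≡-Reasoning

  count-≡ : ∀ v w → count v (v ∷ w) ≡ suc (count v w)
  count-≡ v w with v ≡ᵇ v in eq
  ... | true  = refl
  ... | false = ⊥-elim (subst T eq (≡⇒≡ᵇ v v refl))

  count-≢ : ∀ {v a} w → v ≢ a → count v (a ∷ w) ≡ count v w
  count-≢ {v} {a} w v≢a with v ≡ᵇ a in eq
  ... | true  = ⊥-elim (v≢a (≡ᵇ⇒≡ v a (subst T (sym eq) _)))
  ... | false = refl

  count-++ : ∀ v xs ys → count v (xs ++ ys) ≡ count v xs + count v ys
  count-++ v []       ys = refl
  count-++ v (a ∷ xs) ys with v ≟ a
  ... | yes refl = trans (count-≡ v (xs ++ ys))
                         (trans (cong suc (count-++ v xs ys)) (cong (_+ count v ys) (sym (count-≡ v xs))))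
  ... | no v≢a   = trans (count-≢ (xs ++ ys) v≢a)
                         (trans (count-++ v xs ys) (cong (_+ count v ys) (sym (count-≢ xs v≢a))))

  count-none : ∀ {v} xs → All (_≢ v) xs → count v xs ≡ 0
  count-none []       []           = refl
  count-none (a ∷ xs) (a≢v ∷ xs≢v) = trans (count-≢ xs (a≢v ∘ sym)) (count-none xs xs≢v)

  ∈⇒1≤count : ∀ {v xs} → v ∈ xs → 1 ≤ count v xs
  ∈⇒1≤count {v} (here refl)        = subst (1 ≤_) (sym (count-≡ v _)) (s≤s z≤n)
  ∈⇒1≤count {v} {a ∷ xs} (there v∈) with v ≟ a
  ... | yes refl = subst (1 ≤_) (sym (count-≡ v xs)) (s≤s z≤n)
  ... | no v≢a   = subst (1 ≤_) (sym (count-≢ xs v≢a)) (∈⇒1≤count v∈)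

  1≤count⇒∈ : ∀ {v} xs → 1 ≤ count v xs → v ∈ xs
  1≤count⇒∈ {v} (a ∷ xs) 1≤c with v ≟ a
  ... | yes refl = here refl
  ... | no v≢a   = there (1≤count⇒∈ xs (subst (1 ≤_) (count-≢ xs v≢a) 1≤c))

  shift : ℕ → List ℕ → List ℕ
  shift c = map (c +_)

  count-shift : ∀ c v xs → count (c + v) (shift c xs) ≡ count v xs
  count-shift c v []       = refl
  count-shift c v (a ∷ xs) with v ≟ a
  ... | yes refl = trans (count-≡ (c + v) (shift c xs))
                         (trans (cong suc (count-shift c v xs)) (sym (count-≡ v xs)))
  ... | no v≢a   = trans (count-≢ (shift c xs) (v≢a ∘ +-cancelˡ-≡ c v a))
                         (trans (count-shift c v xs) (sym (count-≢ xs v≢a)))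

  shift-unshift : ∀ c xs → All (c ≤_) xs → shift c (map (_∸ c) xs) ≡ xs
  shift-unshift c []       []             = refl
  shift-unshift c (a ∷ xs) (c≤a ∷ c≤xs)   = cong₂ _∷_ (m+[n∸m]≡n c≤a) (shift-unshift c xs c≤xs)

  countAtMost : ℕ → List ℕ → ℕ
  countAtMost t w = length (filter (_≤? t) w)

  countAtMost-++ : ∀ t xs ys → countAtMost t (xs ++ ys) ≡ countAtMost t xs + countAtMost t ys
  countAtMost-++ t xs ys = trans (cong length (filter-++ (_≤? t) xs ys)) (length-++ (filter (_≤? t) xs))

  countAtMost-suc : ∀ t w → countAtMost (suc t) w ≡ countAtMost t w + count (suc t) w
  countAtMost-suc t []       = refl
  countAtMost-suc t (a ∷ w) with <-cmp a (suc t)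
  ... | tri< a<1+t a≢1+t _ = begin
    countAtMost (suc t) (a ∷ w)
      ≡⟨ cong length (filter-accept (_≤? suc t) (<⇒≤ a<1+t)) ⟩
    suc (countAtMost (suc t) w)
      ≡⟨ cong suc (countAtMost-suc t w) ⟩
    suc (countAtMost t w + count (suc t) w)
      ≡⟨ cong₂ _+_ (cong length (filter-accept (_≤? t) (≤-pred a<1+t))) (count-≢ w (a≢1+t ∘ sym)) ⟨
    countAtMost t (a ∷ w) + count (suc t) (a ∷ w) ∎
  ... | tri≈ _ refl _ = begin
    countAtMost (suc t) (a ∷ w)
      ≡⟨ cong length (filter-accept (_≤? suc t) ≤-refl) ⟩
    suc (countAtMost (suc t) w)
      ≡⟨ cong suc (countAtMost-suc t w) ⟩
    suc (countAtMost t w + count (suc t) w)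
      ≡⟨ +-suc (countAtMost t w) (count (suc t) w) ⟨
    countAtMost t w + suc (count (suc t) w)
      ≡⟨ cong₂ _+_ (cong length (filter-reject (_≤? t) (<⇒≱ ≤-refl))) (count-≡ (suc t) w) ⟨
    countAtMost t (a ∷ w) + count (suc t) (a ∷ w) ∎
  ... | tri> _ a≢1+t 1+t<a = begin
    countAtMost (suc t) (a ∷ w)
      ≡⟨ cong length (filter-reject (_≤? suc t) (<⇒≱ 1+t<a)) ⟩
    countAtMost (suc t) w
      ≡⟨ countAtMost-suc t w ⟩
    countAtMost t w + count (suc t) w
      ≡⟨ cong₂ _+_ (cong length (filter-reject (_≤? t) (<⇒≱ (<-trans (n<1+n t) 1+t<a)))) (count-≢ w (a≢1+t ∘ sym)) ⟨
    countAtMost t (a ∷ w) + count (suc t) (a ∷ w) ∎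

module Permutation where

  open Counting
  open import Data.List.Base using (List; _++_; [_]; map; length)
  open import Data.List.Properties using (length-++; length-map; filter-none)
  open import Data.List.Relation.Unary.All as All using (All; []; _∷_)
  import Data.List.Relation.Unary.All.Properties as All
  open import Data.Nat.Base
  open import Data.Nat.Properties
  open import Data.Product.Base using (_×_; _,_; proj₁; proj₂)
  open import Data.Sum.Base using (_⊎_; inj₁; inj₂)
  open import Defs using (count)
  open import Function.Base using (_∘_)
  open import Relation.Binary.PropositionalEquality hiding ([_])
  open import Relation.Nullary.Decidable using (yes; no)
  open import Algebra.Properties.CommutativeSemigroup +-commutativeSemigroup using (x∙yz≈y∙xz)
  open ≡-Reasoning

  Bounded : ℕ → List ℕ → Set
  Bounded n = All (λ a → 1 ≤ a × a ≤ n)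

  record IsPermutation (n : ℕ) (w : List ℕ) : Set where
    field
      length≡ : length w ≡ n
      bounded : Bounded n w
      once    : ∀ {v} → 1 ≤ v → v ≤ n → count v w ≡ 1

  open IsPermutation

  countAtMost-isPermutation : ∀ {n w} → IsPermutation n w → ∀ {t} → t ≤ n → countAtMost t w ≡ t
  countAtMost-isPermutation {w = w} π {zero}  _     = cong length (filter-none (_≤? 0) (All.map (λ (1≤a , _) → <⇒≱ 1≤a) (bounded π)))
  countAtMost-isPermutation {w = w} π {suc t} 1+t≤n = begin
    countAtMost (suc t) w               ≡⟨ countAtMost-suc t w ⟩
    countAtMost t w + count (suc t) w   ≡⟨ cong₂ _+_ (countAtMost-isPermutation π (<⇒≤ 1+t≤n)) (once π (s≤s z≤n) 1+t≤n) ⟩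
    t + 1                               ≡⟨ +-comm t 1 ⟩
    suc t                               ∎

  ++-comm-isPermutation : ∀ {n} xs ys → IsPermutation n (xs ++ ys) → IsPermutation n (ys ++ xs)
  ++-comm-isPermutation xs ys π = record
    { length≡ = trans (length-++ ys) (trans (+-comm (length ys) (length xs)) (trans (sym (length-++ xs)) (length≡ π)))
    ; bounded = All.++⁺ (All.++⁻ʳ xs (bounded π)) (All.++⁻ˡ xs (bounded π))
    ; once    = λ {v} 1≤v v≤n →
        trans (count-++ v ys xs) (trans (+-comm (count v ys) (count v xs)) (trans (sym (count-++ v xs ys)) (once π 1≤v v≤n)))
    }

  [1]-isPermutation : IsPermutation 1 [ 1 ]
  [1]-isPermutation = record
    { length≡ = refl
    ; bounded = (s≤s z≤n , s≤s z≤n) ∷ []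
    ; once    = λ { (s≤s z≤n) (s≤s z≤n) → refl }
    }

  shift-++-isPermutation : ∀ {m t α ys} → IsPermutation m α → IsPermutation t ys → IsPermutation (t + m) (shift t α ++ ys)
  shift-++-isPermutation {m} {t} {α} {ys} πα πys = record
    { length≡ = begin
        length (shift t α ++ ys)        ≡⟨ length-++ (shift t α) ⟩
        length (shift t α) + length ys  ≡⟨ cong₂ _+_ (trans (length-map (t +_) α) (length≡ πα)) (length≡ πys) ⟩
        m + t                           ≡⟨ +-comm m t ⟩
        t + m                           ∎
    ; bounded = All.++⁺ (All.map⁺ (All.map (λ (1≤a , a≤m) → ≤-trans 1≤a (m≤n+m _ t) , +-monoʳ-≤ t a≤m) (bounded πα)))
                        (All.map (λ (1≤y , y≤t) → 1≤y , ≤-trans y≤t (m≤m+n t m)) (bounded πys))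
    ; once    = once′
    }
    where
    t<α : All (t <_) (shift t α)
    t<α = All.map⁺ (All.map (λ (1≤a , _) → m<m+n t 1≤a) (bounded πα))
    ys≤t : All (_≤ t) ys
    ys≤t = All.map proj₂ (bounded πys)
    once′ : ∀ {v} → 1 ≤ v → v ≤ t + m → count v (shift t α ++ ys) ≡ 1
    once′ {v} 1≤v v≤t+m with v ≤? t
    ... | yes v≤t = begin
      count v (shift t α ++ ys)            ≡⟨ count-++ v (shift t α) ys ⟩
      count v (shift t α) + count v ys     ≡⟨ cong₂ _+_ (count-none (shift t α) (All.map (λ t<a → >⇒≢ (≤-<-trans v≤t t<a)) t<α))
                                                        (once πys 1≤v v≤t) ⟩
      0 + 1                                ∎
    ... | no v≰t = begin
      count v (shift t α ++ ys)                ≡⟨ count-++ v (shift t α) ys ⟩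
      count v (shift t α) + count v ys         ≡⟨ cong (λ z → count z (shift t α) + count v ys) t+u≡v ⟨
      count (t + u) (shift t α) + count v ys   ≡⟨ cong₂ _+_ (count-shift t u α) (count-none ys (All.map (λ y≤t → <⇒≢ (≤-<-trans y≤t t<v)) ys≤t)) ⟩
      count u α + 0                            ≡⟨ cong (_+ 0) (once πα 1≤u u≤m) ⟩
      1                                        ∎
      where
      t<v : t < v
      t<v = ≰⇒> v≰t
      u : ℕ
      u = v ∸ t
      t+u≡v : t + u ≡ v
      t+u≡v = m+[n∸m]≡n (<⇒≤ t<v)
      1≤u : 1 ≤ u
      1≤u = m<n⇒0<n∸m t<v
      u≤m : u ≤ m
      u≤m = +-cancelˡ-≤ t u m (subst (_≤ t + m) (sym t+u≡v) v≤t+m)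

  restrict-isPermutation : ∀ {N c} ls xs rs → IsPermutation N (ls ++ xs ++ rs) → c + length xs ≤ N →
                           All (λ x → c < x × x ≤ c + length xs) xs → All (λ y → y ≤ c ⊎ c + length xs < y) (ls ++ rs) →
                           IsPermutation (length xs) (map (_∸ c) xs)
  restrict-isPermutation {N} {c} ls xs rs π c+l≤N inside outside = record
    { length≡ = length-map (_∸ c) xs
    ; bounded = All.map⁺ (All.map (λ (c<x , x≤c+l) → m<n⇒0<n∸m c<x , subst (_ ≤_) (m+n∸m≡n c _) (∸-monoˡ-≤ c x≤c+l)) inside)
    ; once    = once′
    }
    where
    l = length xs
    once′ : ∀ {v} → 1 ≤ v → v ≤ l → count v (map (_∸ c) xs) ≡ 1
    once′ {v} 1≤v v≤l = begin
      count v (map (_∸ c) xs)                              ≡⟨ count-shift c v (map (_∸ c) xs) ⟨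
      count (c + v) (shift c (map (_∸ c) xs))              ≡⟨ cong (count (c + v)) (shift-unshift c xs (All.map (<⇒≤ ∘ proj₁) inside)) ⟩
      count (c + v) xs                                     ≡⟨ +-identityʳ _ ⟨
      count (c + v) xs + 0                                 ≡⟨ cong (count (c + v) xs +_) (count-none (ls ++ rs) (All.map separated outside)) ⟨
      count (c + v) xs + count (c + v) (ls ++ rs)          ≡⟨ rearrange ⟩
      count (c + v) (ls ++ xs ++ rs)                       ≡⟨ once π (≤-trans 1≤v (m≤n+m v c)) (≤-trans (+-monoʳ-≤ c v≤l) c+l≤N) ⟩
      1                                                    ∎
      where
      separated : ∀ {y} → y ≤ c ⊎ c + l < y → y ≢ c + v
      separated (inj₁ y≤c)   = <⇒≢ (≤-<-trans y≤c (m<m+n c 1≤v))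
      separated (inj₂ c+l<y) = >⇒≢ (≤-<-trans (+-monoʳ-≤ c v≤l) c+l<y)
      rearrange : count (c + v) xs + count (c + v) (ls ++ rs) ≡ count (c + v) (ls ++ xs ++ rs)
      rearrange = begin
        count (c + v) xs + count (c + v) (ls ++ rs)                        ≡⟨ cong (count (c + v) xs +_) (count-++ (c + v) ls rs) ⟩
        count (c + v) xs + (count (c + v) ls + count (c + v) rs)           ≡⟨ x∙yz≈y∙xz (count (c + v) xs) (count (c + v) ls) (count (c + v) rs) ⟩
        count (c + v) ls + (count (c + v) xs + count (c + v) rs)           ≡⟨ cong (count (c + v) ls +_) (count-++ (c + v) xs rs) ⟨
        count (c + v) ls + count (c + v) (xs ++ rs)                        ≡⟨ count-++ (c + v) ls (xs ++ rs) ⟨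
        count (c + v) (ls ++ xs ++ rs)                                     ∎

module Membership where

  open Permutation using (Bounded; IsPermutation)
  open import Data.Bool.Base using (true; false; T; _∧_)
  open import Data.Bool.Properties using (T?; T-∧; T-not-≡)
  open import Data.Empty using (⊥-elim)
  open import Data.List.Base using (List; []; _∷_; _++_; map; concatMap; length; cartesianProductWith)
  open import Data.List.Membership.Propositional using (_∈_)
  open import Data.List.Membership.Propositional.Properties
    using (∈-map⁺; ∈-map⁻; ∈-upTo⁺; ∈-upTo⁻; ∈-filter⁺; ∈-filter⁻; ∈-cartesianProductWith⁺; ∈-cartesianProductWith⁻)
  open import Data.List.Properties using (∷-injective)
  open import Data.List.Relation.Unary.All as All using ([]; _∷_)
  open import Data.List.Relation.Unary.All.Properties using (all⁺; all⁻)
  import Data.List.Relation.Unary.AllPairs as AllPairs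
  open import Data.List.Relation.Unary.Any using (here)
  open import Data.List.Relation.Unary.Unique.Propositional using (Unique)
  import Data.List.Relation.Unary.Unique.Propositional.Properties as Unique
  open import Data.Nat.Base using (ℕ; zero; suc; _≤_; z≤n; s≤s; _≡ᵇ_)
  open import Data.Nat.Properties using (suc-injective; ≡ᵇ⇒≡; ≡⇒≡ᵇ)
  open import Data.Product.Base using (_×_; _,_; proj₁; proj₂; swap)
  open import Defs
  open import Function.Base using (_∘_)
  open import Function.Bundles using (Equivalence)
  open import Relation.Binary.PropositionalEquality
  open import Relation.Nullary.Negation using (¬_)
  open Equivalence using (to; from)

  record IsAv213 (n : ℕ) (w : List ℕ) : Set where
    field
      isPermutation : IsPermutation n w
      avoids        : ¬ T (contains213 w)

    open IsPermutation isPermutation public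

  ∈-range1⁻ : ∀ {v n} → v ∈ range1 n → 1 ≤ v × v ≤ n
  ∈-range1⁻ v∈ with _ , k∈ , refl ← ∈-map⁻ suc v∈ = s≤s z≤n , ∈-upTo⁻ k∈

  ∈-range1⁺ : ∀ {v n} → 1 ≤ v → v ≤ n → v ∈ range1 n
  ∈-range1⁺ {suc v} (s≤s z≤n) v≤n = ∈-map⁺ suc (∈-upTo⁺ v≤n)

  words-suc : ∀ k m → words k (suc m) ≡ cartesianProductWith (λ w a → a ∷ w) (words k m) (range1 k)
  words-suc k m = concatMap-map≡cartesianProductWith (words k m)
    where
    concatMap-map≡cartesianProductWith : ∀ ws →
      concatMap (λ w → map (λ a → a ∷ w) (range1 k)) ws ≡ cartesianProductWith (λ w a → a ∷ w) ws (range1 k)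
    concatMap-map≡cartesianProductWith []       = refl
    concatMap-map≡cartesianProductWith (w ∷ ws) = cong (map (λ a → a ∷ w) (range1 k) ++_) (concatMap-map≡cartesianProductWith ws)

  ∈-words⁻ : ∀ {k} m {w} → w ∈ words k m → length w ≡ m × Bounded k w
  ∈-words⁻ zero (here refl) = refl , []
  ∈-words⁻ {k} (suc m) {w} w∈
    with _ , _ , w′∈ , a∈ , refl ← ∈-cartesianProductWith⁻ _ (words k m) (range1 k) (subst (w ∈_) (words-suc k m) w∈)
    with l , bnd ← ∈-words⁻ m w′∈
    = cong suc l , ∈-range1⁻ a∈ ∷ bnd

  ∈-words⁺ : ∀ {k} m {w} → length w ≡ m → Bounded k w → w ∈ words k m
  ∈-words⁺ zero    {[]}    refl []                = here refl
  ∈-words⁺ {k} (suc m) {a ∷ w} l ((1≤a , a≤k) ∷ bnd) = subst (a ∷ w ∈_) (sym (words-suc k m))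
    (∈-cartesianProductWith⁺ (λ w a → a ∷ w) (∈-words⁺ m (suc-injective l) bnd) (∈-range1⁺ 1≤a a≤k))

  words-unique : ∀ k m → Unique (words k m)
  words-unique k zero    = [] AllPairs.∷ AllPairs.[]
  words-unique k (suc m) = subst Unique (sym (words-suc k m))
    (Unique.cartesianProductWith⁺ (λ w a → a ∷ w) (swap ∘ ∷-injective)
      (words-unique k m) (Unique.map⁺ suc-injective (Unique.upTo⁺ k)))

  isPerm⁻ : ∀ n w → T (isPerm n w) → length w ≡ n × (∀ {v} → 1 ≤ v → v ≤ n → count v w ≡ 1)
  isPerm⁻ n w t with l , once ← to T-∧ t =
    ≡ᵇ⇒≡ (length w) n l ,
    λ 1≤v v≤n → ≡ᵇ⇒≡ _ 1 (All.lookup (all⁺ (λ v → count v w ≡ᵇ 1) (range1 n) once) (∈-range1⁺ 1≤v v≤n))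

  isPerm⁺ : ∀ n w → length w ≡ n → (∀ {v} → 1 ≤ v → v ≤ n → count v w ≡ 1) → T (isPerm n w)
  isPerm⁺ n w l once = from T-∧ (≡⇒≡ᵇ (length w) n l ,
    all⁻ _ (All.tabulate (λ v∈ → ≡⇒≡ᵇ _ 1 (once (proj₁ (∈-range1⁻ v∈)) (proj₂ (∈-range1⁻ v∈))))))

  ∈-Av213⁻ : ∀ n {w} → w ∈ Av213 n → IsAv213 n w
  ∈-Av213⁻ n {w} w∈
    with w∈words , t ← ∈-filter⁻ (λ w → T? (isPerm n w ∧ avoids213 w)) w∈
    with perm , avoid ← to T-∧ t
    with l , bnd ← ∈-words⁻ n w∈words
    = record
      { isPermutation = record { length≡ = l ; bounded = bnd ; once = proj₂ (isPerm⁻ n w perm) }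
      ; avoids        = λ c → subst T (to T-not-≡ avoid) c
      }

  ∈-Av213⁺ : ∀ n {w} → IsAv213 n w → w ∈ Av213 n
  ∈-Av213⁺ n {w} w∈Av = ∈-filter⁺ (λ w → T? (isPerm n w ∧ avoids213 w)) (∈-words⁺ n length≡ bounded)
    (from T-∧ (isPerm⁺ n w length≡ once , from T-not-≡ (¬T⇒≡false avoids)))
    where
    open IsAv213 w∈Av
    ¬T⇒≡false : ∀ {b} → ¬ T b → b ≡ false
    ¬T⇒≡false {false} _ = refl
    ¬T⇒≡false {true}  t = ⊥-elim (t _)

  Av213-unique : ∀ n → Unique (Av213 n)
  Av213-unique n = Unique.filter⁺ (λ w → T? (isPerm n w ∧ avoids213 w)) (words-unique n n)

module Pattern213 where

  open Counting using (shift)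
  open import Data.Bool.Base using (T; _∧_; _∨_)
  open import Data.Bool.ListAction using (any)
  open import Data.Bool.Properties using (T-∨; T-∧)
  open import Data.Empty using (⊥-elim)
  open import Data.List.Base using ([]; _∷_; _++_)
  open import Data.List.Membership.Propositional using (_∈_)
  open import Data.List.Membership.Propositional.Properties using (∈-∃++)
  open import Data.List.Properties using (++-assoc)
  open import Data.List.Relation.Unary.All as All using (All; _∷_)
  open import Data.List.Relation.Unary.All.Properties using (All¬⇒¬Any)
  open import Data.List.Relation.Unary.Any as Any using (Any)
  open import Data.List.Relation.Unary.Any.Properties using (any⁺; any⁻; ++⁺ˡ; ++⁻)
  open import Data.Nat.Base
  open import Data.Nat.Properties using (<ᵇ⇒<; <⇒<ᵇ; <-asym)
  open import Data.Product.Base using (_×_; _,_)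
  open import Data.Sum.Base using (_⊎_; inj₁; inj₂)
  open import Defs using (has13above; contains213)
  open import Function.Base using (_∘_; _∘′_)
  open import Function.Bundles using (Equivalence)
  open import Relation.Binary.PropositionalEquality
  open import Relation.Nullary.Negation using (¬_)
  open Equivalence using (to; from)

  has13above-∷⁻ : ∀ {a b} w → T (has13above a (b ∷ w)) → (b < a × Any (a <_) w) ⊎ T (has13above a w)
  has13above-∷⁻ {a} {b} w t with to (T-∨ {(b <ᵇ a) ∧ any (a <ᵇ_) w}) t
  ... | inj₁ t₁ with b<a , a<w ← to (T-∧ {b <ᵇ a}) t₁ = inj₁ (<ᵇ⇒< b a b<a , Any.map (<ᵇ⇒< a _) (any⁻ _ w a<w))
  ... | inj₂ t₂ = inj₂ t₂

  has13above-∷⁺ˡ : ∀ {a b w} → b < a → Any (a <_) w → T (has13above a (b ∷ w))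
  has13above-∷⁺ˡ {a} {b} {w} b<a a<w =
    from (T-∨ {(b <ᵇ a) ∧ any (a <ᵇ_) w}) (inj₁ (from (T-∧ {b <ᵇ a}) (<⇒<ᵇ b<a , any⁺ _ (Any.map <⇒<ᵇ a<w))))

  has13above-∷⁺ʳ : ∀ {a} b w → T (has13above a w) → T (has13above a (b ∷ w))
  has13above-∷⁺ʳ {a} b w t = from (T-∨ {(b <ᵇ a) ∧ any (a <ᵇ_) w}) (inj₂ t)

  contains213-∷⁻ : ∀ a w → T (contains213 (a ∷ w)) → T (has13above a w) ⊎ T (contains213 w)
  contains213-∷⁻ a w = to (T-∨ {has13above a w})

  contains213-∷⁺ˡ : ∀ a w → T (has13above a w) → T (contains213 (a ∷ w))
  contains213-∷⁺ˡ a w t = from (T-∨ {has13above a w}) (inj₁ t)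

  contains213-∷⁺ʳ : ∀ a w → T (contains213 w) → T (contains213 (a ∷ w))
  contains213-∷⁺ʳ a w t = from (T-∨ {has13above a w}) (inj₂ t)

  has13above-++ʳ : ∀ {a ys} xs → T (has13above a ys) → T (has13above a (xs ++ ys))
  has13above-++ʳ []       t = t
  has13above-++ʳ {a} {ys} (x ∷ xs) t = has13above-∷⁺ʳ {a} x (xs ++ ys) (has13above-++ʳ xs t)

  has13above-++ˡ : ∀ {a} xs ys → T (has13above a xs) → T (has13above a (xs ++ ys))
  has13above-++ˡ {a} (x ∷ xs) ys t with has13above-∷⁻ {a} {x} xs t
  ... | inj₁ (x<a , a<xs) = has13above-∷⁺ˡ {a} {x} {xs ++ ys} x<a (++⁺ˡ a<xs)
  ... | inj₂ t′           = has13above-∷⁺ʳ {a} x (xs ++ ys) (has13above-++ˡ xs ys t′)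

  contains213-++ʳ : ∀ {ys} xs → T (contains213 ys) → T (contains213 (xs ++ ys))
  contains213-++ʳ []       t = t
  contains213-++ʳ {ys} (x ∷ xs) t = contains213-∷⁺ʳ x (xs ++ ys) (contains213-++ʳ xs t)

  contains213-++ˡ : ∀ xs ys → T (contains213 xs) → T (contains213 (xs ++ ys))
  contains213-++ˡ (x ∷ xs) ys t with contains213-∷⁻ x xs t
  ... | inj₁ h  = contains213-∷⁺ˡ x (xs ++ ys) (has13above-++ˡ xs ys h)
  ... | inj₂ t′ = contains213-∷⁺ʳ x (xs ++ ys) (contains213-++ˡ xs ys t′)

  occurrence⇒contains213 : ∀ {x y b} xs ys → x ∈ xs → y ∈ ys → b < x → x < y → T (contains213 (xs ++ b ∷ ys))
  occurrence⇒contains213 {x} {y} {b} xs ys x∈xs y∈ys b<x x<y with ps , qs , refl ← ∈-∃++ x∈xs =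
    subst (T ∘′ contains213) (sym (++-assoc ps (x ∷ qs) (b ∷ ys)))
      (contains213-++ʳ ps (contains213-∷⁺ˡ x (qs ++ b ∷ ys)
        (has13above-++ʳ qs (has13above-∷⁺ˡ {x} {b} {ys} b<x (Any.map (λ { refl → x<y }) y∈ys)))))

  has13above-above : ∀ {a} w → All (a <_) w → ¬ T (has13above a w)
  has13above-above {a} (b ∷ w) (a<b ∷ a<w) t with has13above-∷⁻ {a} {b} w t
  ... | inj₁ (b<a , _) = <-asym a<b b<a
  ... | inj₂ t′        = has13above-above w a<w t′

  contains213-∷-minimum : ∀ {a} w → All (a <_) w → ¬ T (contains213 w) → ¬ T (contains213 (a ∷ w))
  contains213-∷-minimum {a} w a<w w-avoids t with contains213-∷⁻ a w t
  ... | inj₁ h  = has13above-above w a<w h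
  ... | inj₂ t′ = w-avoids t′

  has13above-++-below : ∀ {a} xs ys → All (_< a) ys → T (has13above a (xs ++ ys)) → T (has13above a xs)
  has13above-++-below {a} [] (y ∷ ys) (y<a ∷ ys<a) t with has13above-∷⁻ {a} {y} ys t
  ... | inj₁ (_ , a<ys) = ⊥-elim (All¬⇒¬Any (All.map (λ y<a a<y → <-asym y<a a<y) ys<a) a<ys)
  ... | inj₂ t′        = has13above-++-below [] ys ys<a t′
  has13above-++-below {a} (x ∷ xs) ys ys<a t with has13above-∷⁻ {a} {x} (xs ++ ys) t
  ... | inj₂ t′ = has13above-∷⁺ʳ {a} x xs (has13above-++-below xs ys ys<a t′)
  ... | inj₁ (x<a , a<xs++ys) with ++⁻ xs a<xs++ys
  ...   | inj₁ a<xs = has13above-∷⁺ˡ {a} {x} {xs} x<a a<xs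
  ...   | inj₂ a<ys = ⊥-elim (All¬⇒¬Any (All.map (λ y<a a<y → <-asym y<a a<y) ys<a) a<ys)

  contains213-++-below : ∀ xs ys → ¬ T (contains213 xs) → ¬ T (contains213 ys) →
                         All (λ x → All (_< x) ys) xs → ¬ T (contains213 (xs ++ ys))
  contains213-++-below []       ys _         ys-avoids _             t = ys-avoids t
  contains213-++-below (x ∷ xs) ys xs-avoids ys-avoids (ys<x ∷ ys<xs) t with contains213-∷⁻ x (xs ++ ys) t
  ... | inj₁ h  = xs-avoids (contains213-∷⁺ˡ x xs (has13above-++-below xs ys ys<x h))
  ... | inj₂ t′ = contains213-++-below xs ys (xs-avoids ∘ contains213-∷⁺ʳ x xs) ys-avoids ys<xs t′

  <ᵇ-+ : ∀ c m n → (c + m <ᵇ c + n) ≡ (m <ᵇ n)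
  <ᵇ-+ zero    m n = refl
  <ᵇ-+ (suc c) m n = <ᵇ-+ c m n

  contains213-shift : ∀ c w → contains213 (shift c w) ≡ contains213 w
  contains213-shift c []      = refl
  contains213-shift c (a ∷ w) = cong₂ _∨_ (has13above-shift a w) (contains213-shift c w)
    where
    any-shift : ∀ a w → any (c + a <ᵇ_) (shift c w) ≡ any (a <ᵇ_) w
    any-shift a []      = refl
    any-shift a (b ∷ w) = cong₂ _∨_ (<ᵇ-+ c a b) (any-shift a w)
    has13above-shift : ∀ a w → has13above (c + a) (shift c w) ≡ has13above a w
    has13above-shift a []      = refl
    has13above-shift a (b ∷ w) = cong₂ _∨_ (cong₂ _∧_ (<ᵇ-+ c b a) (any-shift a w)) (has13above-shift a w)

module Decomposition where

  open ListUniqueness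
  open Counting
  open Permutation
  open Membership
  open Pattern213
  open import Data.Bool.Base using (T)
  open import Data.List.Base using (List; []; _∷_; _++_; [_]; map; length; concatMap; upTo)
  open import Data.List.Membership.Propositional using (_∈_; find)
  open import Data.List.Membership.Propositional.Properties using (∈-∃++; ∈-map⁺; ∈-map⁻; ∈-concatMap⁺; ∈-concatMap⁻; ∈-upTo⁺; ∈-upTo⁻)
  open import Data.List.Properties
    using (length-++; ++-assoc; ++-identityʳ; ++-cancelˡ; map-injective; ∷-injectiveˡ; ∷-injectiveʳ;
           filter-none; filter-notAll; filter-all; filter-some; ≡-dec)
  open import Data.List.Relation.Binary.Permutation.Propositional using (_↭_)
  open import Data.List.Relation.Unary.All as All using (All; []; _∷_)
  import Data.List.Relation.Unary.All.Properties as All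
  open import Data.List.Relation.Unary.Any as Any using (there)
  open import Data.List.Relation.Unary.Unique.Propositional using (Unique)
  import Data.List.Relation.Unary.Unique.Propositional.Properties as Unique
  open import Data.Nat.Base
  open import Data.Nat.Properties
  open import Data.Product.Base using (_×_; _,_; proj₁; proj₂; ∃-syntax)
  open import Data.Sum.Base using (inj₁; inj₂)
  open import Defs
  open import Function.Base using (_∘_; case_of_)
  open import Function.Bundles using (mk⇔)
  open import Relation.Binary.PropositionalEquality hiding ([_])
  open import Relation.Nullary.Decidable using (yes; no)
  open import Relation.Nullary.Negation using (¬_; contradiction)
  open ≡-Reasoning

  glue : ℕ → List ℕ → List ℕ → List ℕ
  glue k α β = shift (suc k) α ++ 1 ∷ shift 1 β

  shift-avoids : ∀ c w → ¬ T (contains213 w) → ¬ T (contains213 (shift c w))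
  shift-avoids c w w-avoids = w-avoids ∘ subst T (contains213-shift c w)

  shift-avoids⁻ : ∀ c w → ¬ T (contains213 (shift c w)) → ¬ T (contains213 w)
  shift-avoids⁻ c w shift-avoids = shift-avoids ∘ subst T (sym (contains213-shift c w))

  glue-isAv213 : ∀ {m k α β} → IsAv213 m α → IsAv213 k β → IsAv213 (suc k + m) (glue k α β)
  glue-isAv213 {m} {k} {α} {β} α∈Av β∈Av = record
    { isPermutation = shift-++-isPermutation (isPermutation α∈Av) low-isPermutation
    ; avoids        = contains213-++-below (shift (suc k) α) (1 ∷ shift 1 β) (shift-avoids (suc k) α (avoids α∈Av))
                        (contains213-∷-minimum (shift 1 β) (All.map⁺ (All.map (λ (1≤b , _) → s≤s 1≤b) (bounded β∈Av)))
                                               (shift-avoids 1 β (avoids β∈Av)))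
                        (All.map⁺ (All.map (λ (1≤a , _) → All.map (λ (_ , y≤1+k) → ≤-<-trans y≤1+k (m<m+n (suc k) 1≤a))
                                                                   (IsPermutation.bounded low-isPermutation))
                                           (bounded α∈Av)))
    }
    where
    open IsAv213
    low-isPermutation : IsPermutation (suc k) (1 ∷ shift 1 β)
    low-isPermutation = ++-comm-isPermutation (shift 1 β) [ 1 ] (shift-++-isPermutation (isPermutation β∈Av) [1]-isPermutation)

  module SplitAtOne {n} p q (w∈Av : IsAv213 (suc n) (p ++ 1 ∷ q)) where

    open IsAv213 w∈Av

    k m t : ℕ
    k = length q
    m = length p
    t = suc k

    m+t≡1+n : m + t ≡ suc n
    m+t≡1+n = trans (sym (length-++ p)) length≡

    t≤1+n : t ≤ suc n
    t≤1+n = subst (t ≤_) m+t≡1+n (m≤n+m t m)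

    count-split : ∀ v → count v (p ++ 1 ∷ q) ≡ count v p + count v (1 ∷ q)
    count-split v = count-++ v p (1 ∷ q)

    no-other-one : count 1 p + count 1 q ≡ 0
    no-other-one = suc-injective (begin
      suc (count 1 p + count 1 q)      ≡⟨ +-suc (count 1 p) (count 1 q) ⟨
      count 1 p + suc (count 1 q)      ≡⟨ cong (count 1 p +_) (count-≡ 1 q) ⟨
      count 1 p + count 1 (1 ∷ q)      ≡⟨ count-split 1 ⟨
      count 1 (p ++ 1 ∷ q)             ≡⟨ once (s≤s z≤n) (s≤s z≤n) ⟩
      1                                ∎)

    1<p : All (1 <_) p
    1<p = All.tabulate λ x∈p → ≤∧≢⇒< (proj₁ (All.lookup (All.++⁻ˡ p bounded) x∈p))
      λ { refl → <⇒≢ (∈⇒1≤count x∈p) (sym (m+n≡0⇒m≡0 (count 1 p) no-other-one)) }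

    1<q : All (1 <_) q
    1<q = All.tabulate λ y∈q → ≤∧≢⇒< (proj₁ (All.lookup (All.++⁻ʳ p bounded) (there y∈q)))
      λ { refl → <⇒≢ (∈⇒1≤count y∈q) (sym (m+n≡0⇒n≡0 (count 1 p) no-other-one)) }

    q<p : ∀ {x y} → x ∈ p → y ∈ q → y < x
    q<p {x} {y} x∈p y∈q = ≤∧≢⇒< (≮⇒≥ (avoids ∘ occurrence⇒contains213 p q x∈p y∈q (All.lookup 1<p x∈p))) y≢x
      where
      y≢x : y ≢ x
      y≢x refl = <⇒≢ 2≤count (sym (once 1≤x x≤1+n))
        where
        1≤x = proj₁ (All.lookup (All.++⁻ˡ p bounded) x∈p)
        x≤1+n = proj₂ (All.lookup (All.++⁻ˡ p bounded) x∈p)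
        2≤count : 2 ≤ count x (p ++ 1 ∷ q)
        2≤count = subst (2 ≤_) (sym (count-split x)) (+-mono-≤ (∈⇒1≤count x∈p) (∈⇒1≤count (there y∈q)))

    -- The t = k + 1 smallest values of the permutation are exactly the entries of 1 ∷ q.
    countAtMost-split : countAtMost t p + countAtMost t (1 ∷ q) ≡ t
    countAtMost-split = trans (sym (countAtMost-++ t p (1 ∷ q))) (countAtMost-isPermutation isPermutation t≤1+n)

    q≤t : All (_≤ t) q
    q≤t = All.tabulate q≤t′
      where
      q≤t′ : ∀ {y} → y ∈ q → y ≤ t
      q≤t′ {y} y∈q with y ≤? t
      ... | yes y≤t = y≤t
      ... | no y≰t  = contradiction (filter-notAll (_≤? t) (1 ∷ q) (there (Any.map (λ { refl → y≰t }) y∈q))) (≤⇒≯ (≤-reflexive (sym low-full)))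
        where
        p-high : countAtMost t p ≡ 0
        p-high = cong length (filter-none (_≤? t) (All.tabulate λ x∈p → <⇒≱ (<-trans (≰⇒> y≰t) (q<p x∈p y∈q))))
        low-full : countAtMost t (1 ∷ q) ≡ length (1 ∷ q)
        low-full = trans (sym (cong (_+ countAtMost t (1 ∷ q)) p-high)) countAtMost-split

    t<p : All (t <_) p
    t<p = All.tabulate t<p′
      where
      t<p′ : ∀ {x} → x ∈ p → t < x
      t<p′ {x} x∈p with x ≤? t
      ... | no x≰t  = ≰⇒> x≰t
      ... | yes x≤t = contradiction (filter-some (_≤? t) (Any.map (λ { refl → x≤t }) x∈p)) (≤⇒≯ (≤-reflexive p-low))
        where
        low-full : countAtMost t (1 ∷ q) ≡ t
        low-full = cong length (filter-all (_≤? t) (s≤s z≤n ∷ q≤t))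
        p-low : countAtMost t p ≡ 0
        p-low = +-cancelʳ-≡ t _ 0 (trans (cong (countAtMost t p +_) (sym low-full)) countAtMost-split)

    α β : List ℕ
    α = map (_∸ t) p
    β = map (_∸ 1) q

    shift-α : shift t α ≡ p
    shift-α = shift-unshift t p (All.map <⇒≤ t<p)

    shift-β : shift 1 β ≡ q
    shift-β = shift-unshift 1 q (All.map <⇒≤ 1<q)

    t+m≡1+n : t + m ≡ suc n
    t+m≡1+n = trans (+-comm t m) m+t≡1+n

    α∈Av : IsAv213 m α
    α∈Av = record
      { isPermutation = restrict-isPermutation [] p (1 ∷ q) isPermutation (≤-reflexive t+m≡1+n)
                          (All.zipWith (λ (t<x , x≤1+n) → t<x , ≤-trans x≤1+n (≤-reflexive (sym t+m≡1+n)))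
                                       (t<p , All.map proj₂ (All.++⁻ˡ p bounded)))
                          (All.map inj₁ (s≤s z≤n ∷ q≤t))
      ; avoids        = shift-avoids⁻ t α
                          (subst (λ xs → ¬ T (contains213 xs)) (sym shift-α) (avoids ∘ contains213-++ˡ p (1 ∷ q)))
      }

    β∈Av : IsAv213 k β
    β∈Av = record
      { isPermutation = restrict-isPermutation (p ++ [ 1 ]) q [] (subst (IsPermutation (suc n)) regroup isPermutation) t≤1+n
                          (All.zipWith (λ (1<y , y≤t) → 1<y , y≤t) (1<q , q≤t))
                          (All.++⁺ (All.++⁺ (All.map inj₂ t<p) (inj₁ ≤-refl ∷ [])) [])
      ; avoids        = shift-avoids⁻ 1 β
                          (subst (λ xs → ¬ T (contains213 xs)) (sym shift-β) (avoids ∘ contains213-++ʳ p ∘ contains213-∷⁺ʳ 1 q))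
      }
      where
      regroup : p ++ 1 ∷ q ≡ (p ++ [ 1 ]) ++ q ++ []
      regroup = trans (sym (++-assoc p [ 1 ] q)) (cong ((p ++ [ 1 ]) ++_) (sym (++-identityʳ q)))

    w≡glue : p ++ 1 ∷ q ≡ glue k α β
    w≡glue = sym (cong₂ (λ xs ys → xs ++ 1 ∷ ys) shift-α shift-β)

  ∉-++-∷-cancel : ∀ {a : ℕ} xs xs′ {ys ys′} → All (a ≢_) xs → All (a ≢_) xs′ →
                  xs ++ a ∷ ys ≡ xs′ ++ a ∷ ys′ → xs ≡ xs′ × ys ≡ ys′
  ∉-++-∷-cancel []       []         _          _            refl = refl , refl
  ∉-++-∷-cancel []       (x′ ∷ xs′) _          (a≢x′ ∷ _)   refl = contradiction refl a≢x′
  ∉-++-∷-cancel (x ∷ xs) []         (a≢x ∷ _)  _            refl = contradiction refl a≢x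
  ∉-++-∷-cancel (x ∷ xs) (x′ ∷ xs′) (_ ∷ a∉xs) (_ ∷ a∉xs′) eq
    with refl ← ∷-injectiveˡ eq
    with xs≡xs′ , ys≡ys′ ← ∉-++-∷-cancel xs xs′ a∉xs a∉xs′ (∷-injectiveʳ eq)
    = cong (x ∷_) xs≡xs′ , ys≡ys′

  one-absent : ∀ k {α} → All (1 ≤_) α → All (1 ≢_) (shift (suc k) α)
  one-absent k 1≤α = All.map⁺ (All.map (λ 1≤a → <⇒≢ (s≤s (≤-trans 1≤a (m≤n+m _ k)))) 1≤α)

  glue-injective : ∀ {k k′ α α′ β β′} → All (1 ≤_) α → All (1 ≤_) α′ → length β ≡ k → length β′ ≡ k′ →
                   glue k α β ≡ glue k′ α′ β′ → k ≡ k′ × α ≡ α′ × β ≡ β′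
  glue-injective {k} {k′} {α} {α′} {β} {β′} 1≤α 1≤α′ refl refl eq = k≡k′ , α≡α′ , β≡β′
    where
    parts : shift (suc k) α ≡ shift (suc k′) α′ × shift 1 β ≡ shift 1 β′
    parts = ∉-++-∷-cancel (shift (suc k) α) (shift (suc k′) α′) (one-absent k 1≤α) (one-absent k′ 1≤α′) eq
    β≡β′ : β ≡ β′
    β≡β′ = map-injective suc-injective (proj₂ parts)
    k≡k′ : k ≡ k′
    k≡k′ = cong length β≡β′
    α≡α′ : α ≡ α′
    α≡α′ = map-injective (+-cancelˡ-≡ (suc k) _ _) (trans (proj₁ parts) (cong (λ j → shift (suc j) α′) (sym k≡k′)))

  glue-injectiveʳ : ∀ k α {β β′} → glue k α β ≡ glue k α β′ → β ≡ β′
  glue-injectiveʳ k α eq = map-injective suc-injective (∷-injectiveʳ (++-cancelˡ (shift (suc k) α) _ _ eq))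

  gluingsOf : ℕ → ℕ → List (List ℕ)
  gluingsOf m k = concatMap (λ α → map (glue k α) (Av213 k)) (Av213 m)

  gluings : ℕ → List (List ℕ)
  gluings n = concatMap (λ k → gluingsOf (n ∸ k) k) (upTo (suc n))

  ∈-gluingsOf⁻ : ∀ m k {w} → w ∈ gluingsOf m k → ∃[ α ] ∃[ β ] α ∈ Av213 m × β ∈ Av213 k × w ≡ glue k α β
  ∈-gluingsOf⁻ m k w∈
    with α , α∈ , w∈′ ← find (∈-concatMap⁻ (λ α → map (glue k α) (Av213 k)) {xs = Av213 m} w∈)
    with β , β∈ , refl ← ∈-map⁻ (glue k α) w∈′
    = α , β , α∈ , β∈ , refl

  ∈-concatMap⁺′ : ∀ {A B : Set} (f : A → List B) {xs x y} → x ∈ xs → y ∈ f x → y ∈ concatMap f xs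
  ∈-concatMap⁺′ f x∈xs y∈fx = ∈-concatMap⁺ f (Any.map (λ { refl → y∈fx }) x∈xs)

  ∈-gluings⁻ : ∀ n {w} → w ∈ gluings n → w ∈ Av213 (suc n)
  ∈-gluings⁻ n w∈
    with k , k∈ , w∈′ ← find (∈-concatMap⁻ (λ k → gluingsOf (n ∸ k) k) {xs = upTo (suc n)} w∈)
    with α , β , α∈ , β∈ , refl ← ∈-gluingsOf⁻ (n ∸ k) k w∈′
    = ∈-Av213⁺ (suc n) (subst (λ N → IsAv213 N (glue k α β)) (cong suc (m+[n∸m]≡n (≤-pred (∈-upTo⁻ k∈))))
                         (glue-isAv213 (∈-Av213⁻ (n ∸ k) α∈) (∈-Av213⁻ k β∈)))

  ∈-gluings⁺ : ∀ n {w} → w ∈ Av213 (suc n) → w ∈ gluings n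
  ∈-gluings⁺ n {w} w∈ with ∈-Av213⁻ (suc n) w∈
  ... | w∈Av with p , q , refl ← ∈-∃++ (1≤count⇒∈ w (≤-reflexive (sym (IsAv213.once w∈Av (s≤s z≤n) (s≤s z≤n))))) =
    subst (_∈ gluings n) (sym w≡glue)
      (∈-concatMap⁺′ (λ k → gluingsOf (n ∸ k) k) (∈-upTo⁺ (s≤s k≤n))
        (∈-concatMap⁺′ (λ α → map (glue k α) (Av213 k)) (subst (λ j → α ∈ Av213 j) m≡n∸k (∈-Av213⁺ m α∈Av))
          (∈-map⁺ (glue k α) (∈-Av213⁺ k β∈Av))))
    where
    open SplitAtOne p q w∈Av
    m+k≡n : m + k ≡ n
    m+k≡n = suc-injective (trans (sym (+-suc m k)) m+t≡1+n)
    k≤n : k ≤ n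
    k≤n = subst (k ≤_) m+k≡n (m≤n+m k m)
    m≡n∸k : m ≡ n ∸ k
    m≡n∸k = trans (sym (m+n∸n≡m m k)) (cong (_∸ k) m+k≡n)

  gluings-unique : ∀ n → Unique (gluings n)
  gluings-unique n =
    concatMap-unique (λ k → gluingsOf (n ∸ k) k) (Unique.upTo⁺ (suc n)) (λ {k} _ → gluingsOf-unique (n ∸ k) k) sizes-disjoint
    where
    positive : ∀ m {α} → α ∈ Av213 m → All (1 ≤_) α
    positive m α∈ = All.map proj₁ (IsAv213.bounded (∈-Av213⁻ m α∈))
    size : ∀ k {β} → β ∈ Av213 k → length β ≡ k
    size k β∈ = IsAv213.length≡ (∈-Av213⁻ k β∈)
    gluingsOf-unique : ∀ m k → Unique (gluingsOf m k)
    gluingsOf-unique m k = concatMap-unique (λ α → map (glue k α) (Av213 k)) (Av213-unique m)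
      (λ {α} _ → Unique.map⁺ (glue-injectiveʳ k α) (Av213-unique k))
      λ {α} {α′} α∈ α′∈ w∈ w∈′ → case ∈-map⁻ (glue k α) w∈ , ∈-map⁻ (glue k α′) w∈′ of λ where
        ((β , β∈ , refl) , (β′ , β′∈ , eq)) →
          proj₁ (proj₂ (glue-injective (positive m α∈) (positive m α′∈) (size k β∈) (size k β′∈) eq))
    sizes-disjoint : ∀ {k k′ w} → k ∈ upTo (suc n) → k′ ∈ upTo (suc n) →
                     w ∈ gluingsOf (n ∸ k) k → w ∈ gluingsOf (n ∸ k′) k′ → k ≡ k′
    sizes-disjoint {k} {k′} _ _ w∈ w∈′ with ∈-gluingsOf⁻ (n ∸ k) k w∈ | ∈-gluingsOf⁻ (n ∸ k′) k′ w∈′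
    ... | α , β , α∈ , β∈ , refl | α′ , β′ , α′∈ , β′∈ , eq =
      proj₁ (glue-injective (positive (n ∸ k) α∈) (positive (n ∸ k′) α′∈) (size k β∈) (size k′ β′∈) eq)

  Av213-suc↭gluings : ∀ n → Av213 (suc n) ↭ gluings n
  Av213-suc↭gluings n =
    unique-⇔⇒↭ (≡-dec _≟_) (Av213-unique (suc n)) (gluings-unique n) (mk⇔ (∈-gluings⁺ n) (∈-gluings⁻ n))

module HorizontalEdges where

  open Counting using (shift)
  open Decomposition using (glue)
  open import Data.List.Base using ([]; _∷_; _++_; length)
  open import Data.List.Relation.Unary.All as All using (All; _∷_)
  import Data.List.Relation.Unary.All.Properties as All
  open import Data.Nat.Base
  open import Data.Nat.Properties using (+-distribˡ-⊓; *-zeroʳ; ⊓-zeroʳ)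
  open import Data.Nat.Tactic.RingSolver using (solve-∀)
  open import Defs using (H)
  open import Relation.Binary.PropositionalEquality
  open ≡-Reasoning

  H-shift : ∀ c w → H (shift c w) ≡ H w + c * (length w ∸ 1)
  H-shift c []          = sym (*-zeroʳ c)
  H-shift c (a ∷ [])    = sym (*-zeroʳ c)
  H-shift c (a ∷ b ∷ w) = begin
    (c + a) ⊓ (c + b) + H (shift c (b ∷ w))     ≡⟨ cong₂ _+_ (+-distribˡ-⊓ c a b) (sym (H-shift c (b ∷ w))) ⟨
    (c + a ⊓ b) + (H (b ∷ w) + c * length w)    ≡⟨ regroup c (a ⊓ b) (H (b ∷ w)) (length w) ⟩
    a ⊓ b + H (b ∷ w) + c * suc (length w)      ∎
    where
    regroup : ∀ c m h l → (c + m) + (h + c * l) ≡ m + h + c * suc l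
    regroup = solve-∀

  H-1∷shift1 : ∀ w → H (1 ∷ shift 1 w) ≡ H w + length w
  H-1∷shift1 []      = refl
  H-1∷shift1 (b ∷ w) = trans (cong suc (H-shift 1 (b ∷ w))) (regroup (H (b ∷ w)) (length w))
    where
    regroup : ∀ h l → suc (h + 1 * l) ≡ h + suc l
    regroup = solve-∀

  H-++-1∷ : ∀ a xs ys → All (1 ≤_) (a ∷ xs) → H ((a ∷ xs) ++ 1 ∷ ys) ≡ H (a ∷ xs) + 1 + H (1 ∷ ys)
  H-++-1∷ (suc a) []       ys _              = cong (λ m → suc m + H (1 ∷ ys)) (⊓-zeroʳ a)
  H-++-1∷ a       (b ∷ xs) ys (_ ∷ 1≤b∷xs) =
    trans (cong (a ⊓ b +_) (H-++-1∷ b xs ys 1≤b∷xs)) (regroup (a ⊓ b) (H (b ∷ xs)) (H (1 ∷ ys)))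
    where
    regroup : ∀ m h g → m + (h + 1 + g) ≡ m + h + 1 + g
    regroup = solve-∀

  -- Shifting α by k + 1 raises the minima of its |α| - 1 adjacent pairs by k + 1, the one or two pairs
  -- containing the entry 1 contribute 1 each, and shifting β by 1 raises its k - 1 minima by 1.
  glueGain : ℕ → ℕ → ℕ
  glueGain k zero    = k
  glueGain k (suc m) = suc m * suc k

  H-glue : ∀ {k} α β → length β ≡ k → H (glue k α β) ≡ H α + H β + glueGain k (length α)
  H-glue []      β refl = H-1∷shift1 β
  H-glue {k} (a ∷ α) β refl = begin
    H (shift (suc k) (a ∷ α) ++ 1 ∷ shift 1 β)                  ≡⟨ H-++-1∷ (suc k + a) (shift (suc k) α) (shift 1 β) (All.map⁺ (All.universal (λ _ → s≤s z≤n) (a ∷ α))) ⟩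
    H (shift (suc k) (a ∷ α)) + 1 + H (1 ∷ shift 1 β)           ≡⟨ cong₂ (λ x y → x + 1 + y) (H-shift (suc k) (a ∷ α)) (H-1∷shift1 β) ⟩
    H (a ∷ α) + suc k * length α + 1 + (H β + length β)         ≡⟨ regroup (H (a ∷ α)) (length α) (H β) (length β) ⟩
    H (a ∷ α) + H β + suc (length α) * suc (length β)           ∎
    where
    regroup : ∀ h l g k → h + suc k * l + 1 + (g + k) ≡ h + g + suc l * suc k
    regroup = solve-∀

module Recurrences where

  open ListSum
  open AntidiagonalSum using (antidiagonalSum)
  open Membership
  open Decomposition
  open HorizontalEdges
  open import Data.List.Base using (List; map; length; upTo)
  open import Data.List.Membership.Propositional using (_∈_)
  open import Data.List.Properties using (length-map; map-∘)
  open import Data.List.Relation.Binary.Permutation.Propositional.Properties using (↭-length; map⁺)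
  open import Data.Nat.Base
  open import Data.Nat.ListAction using (sum)
  open import Data.Nat.ListAction.Properties using (sum-↭)
  open import Data.Nat.Properties using (+-commutativeSemigroup)
  open import Data.Nat.Tactic.RingSolver using (solve-∀)
  open import Defs
  open import Relation.Binary.PropositionalEquality
  open import Algebra.Properties.CommutativeSemigroup +-commutativeSemigroup using (xy∙z≈xz∙y)
  open ≡-Reasoning

  #Av213 : ℕ → ℕ
  #Av213 n = length (Av213 n)

  length-gluingsOf : ∀ m k → length (gluingsOf m k) ≡ #Av213 m * #Av213 k
  length-gluingsOf m k = begin
    length (gluingsOf m k)                                          ≡⟨ length-concatMap (λ α → map (glue k α) (Av213 k)) (Av213 m) ⟩
    sum (map (λ α → length (map (glue k α) (Av213 k))) (Av213 m))   ≡⟨ sum-map-cong (Av213 m) (λ {α} _ → length-map (glue k α) (Av213 k)) ⟩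
    sum (map (λ _ → #Av213 k) (Av213 m))                            ≡⟨ sum-map-const (#Av213 k) (Av213 m) ⟩
    #Av213 m * #Av213 k                                             ∎

  #Av213-suc : ∀ n → #Av213 (suc n) ≡ antidiagonalSum (λ k m → #Av213 m * #Av213 k) n
  #Av213-suc n = begin
    #Av213 (suc n)                                                  ≡⟨ ↭-length (Av213-suc↭gluings n) ⟩
    length (gluings n)                                              ≡⟨ length-concatMap (λ k → gluingsOf (n ∸ k) k) (upTo (suc n)) ⟩
    sum (map (λ k → length (gluingsOf (n ∸ k) k)) (upTo (suc n)))  ≡⟨ sum-map-cong (upTo (suc n)) (λ {k} _ → length-gluingsOf (n ∸ k) k) ⟩
    antidiagonalSum (λ k m → #Av213 m * #Av213 k) n                 ∎

  Hsum-gluingsOf : ∀ m k → sum (map H (gluingsOf m k)) ≡ Hsum m * #Av213 k + #Av213 m * Hsum k + #Av213 m * #Av213 k * glueGain k m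
  Hsum-gluingsOf m k = begin
    sum (map H (gluingsOf m k))
      ≡⟨ sum-map-concatMap H (λ α → map (glue k α) (Av213 k)) (Av213 m) ⟩
    sum (map (λ α → sum (map H (map (glue k α) (Av213 k)))) (Av213 m))
      ≡⟨ sum-map-cong (Av213 m) (λ α∈ → Hsum-glue α∈) ⟩
    sum (map (λ α → #Av213 k * (H α + g) + Hsum k) (Av213 m))
      ≡⟨ sum-map-+ (λ α → #Av213 k * (H α + g)) (λ _ → Hsum k) (Av213 m) ⟩
    sum (map (λ α → #Av213 k * (H α + g)) (Av213 m)) + sum (map (λ _ → Hsum k) (Av213 m))
      ≡⟨ cong₂ _+_ (trans (sum-map-*ˡ (#Av213 k) (λ α → H α + g) (Av213 m)) (cong (#Av213 k *_) (sum-map-+ H (λ _ → g) (Av213 m))))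
                   (sum-map-const (Hsum k) (Av213 m)) ⟩
    #Av213 k * (Hsum m + sum (map (λ _ → g) (Av213 m))) + #Av213 m * Hsum k
      ≡⟨ cong (λ z → #Av213 k * (Hsum m + z) + #Av213 m * Hsum k) (sum-map-const g (Av213 m)) ⟩
    #Av213 k * (Hsum m + #Av213 m * g) + #Av213 m * Hsum k
      ≡⟨ regroup (#Av213 k) (#Av213 m) (Hsum m) (Hsum k) g ⟩
    Hsum m * #Av213 k + #Av213 m * Hsum k + #Av213 m * #Av213 k * g ∎
    where
    g = glueGain k m
    regroup : ∀ c d h j g → c * (h + d * g) + d * j ≡ h * c + d * j + d * c * g
    regroup = solve-∀
    Hsum-glue : ∀ {α} → α ∈ Av213 m → sum (map H (map (glue k α) (Av213 k))) ≡ #Av213 k * (H α + g) + Hsum k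
    Hsum-glue {α} α∈ = begin
      sum (map H (map (glue k α) (Av213 k)))               ≡⟨ cong sum (map-∘ (Av213 k)) ⟨
      sum (map (λ β → H (glue k α β)) (Av213 k))           ≡⟨ sum-map-cong (Av213 k) (λ β∈ → H-glue-sizes β∈) ⟩
      sum (map (λ β → (H α + g) + H β) (Av213 k))          ≡⟨ sum-map-+ (λ _ → H α + g) H (Av213 k) ⟩
      sum (map (λ _ → H α + g) (Av213 k)) + Hsum k         ≡⟨ cong (_+ Hsum k) (sum-map-const (H α + g) (Av213 k)) ⟩
      #Av213 k * (H α + g) + Hsum k                        ∎
      where
      H-glue-sizes : ∀ {β} → β ∈ Av213 k → H (glue k α β) ≡ (H α + g) + H β
      H-glue-sizes {β} β∈ = begin
        H (glue k α β)                           ≡⟨ H-glue α β (IsAv213.length≡ (∈-Av213⁻ k β∈)) ⟩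
        H α + H β + glueGain k (length α)        ≡⟨ cong (λ l → H α + H β + glueGain k l) (IsAv213.length≡ (∈-Av213⁻ m α∈)) ⟩
        H α + H β + g                            ≡⟨ xy∙z≈xz∙y (H α) (H β) g ⟩
        H α + g + H β                            ∎

  Hsum-suc : ∀ n → Hsum (suc n) ≡ antidiagonalSum (λ k m → Hsum m * #Av213 k + #Av213 m * Hsum k + #Av213 m * #Av213 k * glueGain k m) n
  Hsum-suc n = begin
    Hsum (suc n)                                                    ≡⟨ sum-↭ (map⁺ H (Av213-suc↭gluings n)) ⟩
    sum (map H (gluings n))                                         ≡⟨ sum-map-concatMap H (λ k → gluingsOf (n ∸ k) k) (upTo (suc n)) ⟩
    sum (map (λ k → sum (map H (gluingsOf (n ∸ k) k))) (upTo (suc n)))  ≡⟨ sum-map-cong (upTo (suc n)) (λ {k} _ → Hsum-gluingsOf (n ∸ k) k) ⟩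
    antidiagonalSum (λ k m → Hsum m * #Av213 k + #Av213 m * Hsum k + #Av213 m * #Av213 k * glueGain k m) n ∎

module PowerSeries where

  open import Algebra.Bundles using (CommutativeRing)
  import Algebra.Solver.Ring
  open import Algebra.Solver.Ring.AlmostCommutativeRing
    using (AlmostCommutativeRing; fromCommutativeRing; _-Raw-AlmostCommutative⟶_)
  open import Data.Integer.Base using (ℤ; 0ℤ; 1ℤ; _+_; _*_; -_)
  import Data.Integer.Properties as ℤ
  open import Data.Integer.Tactic.RingSolver using (solve-∀)
  open import Data.Maybe.Base using (Maybe; just; nothing)
  open import Data.Nat.Base using (ℕ; zero; suc)
  open import Data.Product.Base using (_,_)
  open import Level using (0ℓ)
  open import Relation.Binary.PropositionalEquality
  open import Relation.Nullary.Decidable using (yes; no)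

  Series : Set
  Series = ℕ → ℤ

  infix  4 _≋_
  infixl 6 _⊕_
  infixl 7 _⊛_

  _≋_ : Series → Series → Set
  u ≋ v = ∀ n → u n ≡ v n

  _⊕_ : Series → Series → Series
  (u ⊕ v) n = u n + v n

  ⊖_ : Series → Series
  (⊖ u) n = - u n

  const : ℤ → Series
  const a zero    = a
  const a (suc n) = 0ℤ

  𝟘 𝟙 X : Series
  𝟘 n = 0ℤ
  𝟙 = const 1ℤ
  X zero    = 0ℤ
  X (suc n) = 𝟙 n

  tail : Series → Series
  tail u n = u (suc n)

  scale : ℤ → Series → Series
  scale a u n = a * u n

  _⊛_ : Series → Series → Series
  (u ⊛ v) zero    = u 0 * v 0
  (u ⊛ v) (suc n) = u 0 * v (suc n) + (tail u ⊛ v) n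

  ⊛-cong : ∀ {u u′ v v′} → u ≋ u′ → v ≋ v′ → u ⊛ v ≋ u′ ⊛ v′
  ⊛-cong p q zero    = cong₂ _*_ (p 0) (q 0)
  ⊛-cong p q (suc n) = cong₂ _+_ (cong₂ _*_ (p 0) (q (suc n))) (⊛-cong (λ k → p (suc k)) q n)

  ⊛-zeroˡ : ∀ v → 𝟘 ⊛ v ≋ 𝟘
  ⊛-zeroˡ v zero    = refl
  ⊛-zeroˡ v (suc n) = trans (ℤ.+-identityˡ _) (⊛-zeroˡ v n)

  ⊛-identityˡ : ∀ v → 𝟙 ⊛ v ≋ v
  ⊛-identityˡ v zero    = ℤ.*-identityˡ (v 0)
  ⊛-identityˡ v (suc n) =
    trans (cong₂ _+_ (ℤ.*-identityˡ (v (suc n))) (⊛-zeroˡ v n)) (ℤ.+-identityʳ _)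

  ⊛-identityʳ : ∀ u → u ⊛ 𝟙 ≋ u
  ⊛-identityʳ u zero    = ℤ.*-identityʳ (u 0)
  ⊛-identityʳ u (suc n) =
    trans (cong₂ _+_ (ℤ.*-zeroʳ (u 0)) (⊛-identityʳ (tail u) n)) (ℤ.+-identityˡ _)

  ⊛-distribʳ : ∀ v u u′ → (u ⊕ u′) ⊛ v ≋ u ⊛ v ⊕ u′ ⊛ v
  ⊛-distribʳ v u u′ zero    = ℤ.*-distribʳ-+ (v 0) (u 0) (u′ 0)
  ⊛-distribʳ v u u′ (suc n) = begin
    (u 0 + u′ 0) * v (suc n) + ((tail u ⊕ tail u′) ⊛ v) n
      ≡⟨ cong₂ _+_ (ℤ.*-distribʳ-+ (v (suc n)) (u 0) (u′ 0)) (⊛-distribʳ v (tail u) (tail u′) n) ⟩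
    (u 0 * v (suc n) + u′ 0 * v (suc n)) + ((tail u ⊛ v) n + (tail u′ ⊛ v) n)
      ≡⟨ interchange (u 0 * v (suc n)) (u′ 0 * v (suc n)) ((tail u ⊛ v) n) ((tail u′ ⊛ v) n) ⟩
    (u 0 * v (suc n) + (tail u ⊛ v) n) + (u′ 0 * v (suc n) + (tail u′ ⊛ v) n) ∎
    where
    open ≡-Reasoning
    interchange : ∀ a b c d → (a + b) + (c + d) ≡ (a + c) + (b + d)
    interchange = solve-∀

  scale-⊛ : ∀ a u v → scale a u ⊛ v ≋ scale a (u ⊛ v)
  scale-⊛ a u v zero    = ℤ.*-assoc a (u 0) (v 0)
  scale-⊛ a u v (suc n) =
    trans (cong₂ _+_ (ℤ.*-assoc a (u 0) (v (suc n))) (scale-⊛ a (tail u) v n))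
          (sym (ℤ.*-distribˡ-+ a _ _))

  ⊛-comm : ∀ u v → u ⊛ v ≋ v ⊛ u
  ⊛-comm u v zero          = ℤ.*-comm (u 0) (v 0)
  ⊛-comm u v (suc zero)    = swap (u 0) (v 1) (u 1) (v 0)
    where
    swap : ∀ a b c d → a * b + c * d ≡ d * c + b * a
    swap = solve-∀
  ⊛-comm u v (suc n@(suc m)) = begin
    u 0 * v (suc n) + (tail u ⊛ v) n
      ≡⟨ cong ((u 0 * v (suc n)) +_) (⊛-comm (tail u) v n) ⟩
    u 0 * v (suc n) + (v 0 * u (suc n) + (tail v ⊛ tail u) m)
      ≡⟨ cong (λ z → u 0 * v (suc n) + (v 0 * u (suc n) + z)) (⊛-comm (tail v) (tail u) m) ⟩
    u 0 * v (suc n) + (v 0 * u (suc n) + (tail u ⊛ tail v) m)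
      ≡⟨ exchange (u 0 * v (suc n)) (v 0 * u (suc n)) ((tail u ⊛ tail v) m) ⟩
    v 0 * u (suc n) + (u 0 * v (suc n) + (tail u ⊛ tail v) m)
      ≡⟨ cong ((v 0 * u (suc n)) +_) (⊛-comm u (tail v) n) ⟩
    v 0 * u (suc n) + (tail v ⊛ u) n ∎
    where
    open ≡-Reasoning
    exchange : ∀ a b c → a + (b + c) ≡ b + (a + c)
    exchange = solve-∀

  ⊛-assoc : ∀ u v w → (u ⊛ v) ⊛ w ≋ u ⊛ (v ⊛ w)
  ⊛-assoc u v w zero    = ℤ.*-assoc (u 0) (v 0) (w 0)
  ⊛-assoc u v w (suc n) = begin
    (u 0 * v 0) * w (suc n) + (tail (u ⊛ v) ⊛ w) n
      ≡⟨ cong ((u 0 * v 0) * w (suc n) +_) (⊛-distribʳ w (scale (u 0) (tail v)) (tail u ⊛ v) n) ⟩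
    (u 0 * v 0) * w (suc n) + ((scale (u 0) (tail v) ⊛ w) n + ((tail u ⊛ v) ⊛ w) n)
      ≡⟨ cong₂ (λ a b → (u 0 * v 0) * w (suc n) + (a + b)) (scale-⊛ (u 0) (tail v) w n) (⊛-assoc (tail u) v w n) ⟩
    (u 0 * v 0) * w (suc n) + (u 0 * (tail v ⊛ w) n + (tail u ⊛ (v ⊛ w)) n)
      ≡⟨ factor (u 0) (v 0) (w (suc n)) ((tail v ⊛ w) n) ((tail u ⊛ (v ⊛ w)) n) ⟩
    u 0 * (v 0 * w (suc n) + (tail v ⊛ w) n) + (tail u ⊛ (v ⊛ w)) n ∎
    where
    open ≡-Reasoning
    factor : ∀ a b c d e → (a * b) * c + (a * d + e) ≡ a * (b * c + d) + e
    factor = solve-∀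

  ⊛-distribˡ : ∀ u v v′ → u ⊛ (v ⊕ v′) ≋ u ⊛ v ⊕ u ⊛ v′
  ⊛-distribˡ u v v′ n = trans (⊛-comm u (v ⊕ v′) n)
    (trans (⊛-distribʳ u v v′ n) (cong₂ _+_ (⊛-comm v u n) (⊛-comm v′ u n)))

  series-commutativeRing : CommutativeRing 0ℓ 0ℓ
  series-commutativeRing = record
    { Carrier = Series ; _≈_ = _≋_ ; _+_ = _⊕_ ; _*_ = _⊛_ ; -_ = ⊖_ ; 0# = 𝟘 ; 1# = 𝟙
    ; isCommutativeRing = record
      { isRing = record
        { +-isAbelianGroup = record
          { isGroup = record
            { isMonoid = record
              { isSemigroup = record
                { isMagma = record
                  { isEquivalence = record
                    { refl = λ n → refl ; sym = λ p n → sym (p n) ; trans = λ p q n → trans (p n) (q n) }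
                  ; ∙-cong = λ p q n → cong₂ _+_ (p n) (q n) }
                ; assoc = λ u v w n → ℤ.+-assoc (u n) (v n) (w n) }
              ; identity = (λ u n → ℤ.+-identityˡ (u n)) , (λ u n → ℤ.+-identityʳ (u n)) }
            ; inverse = (λ u n → ℤ.+-inverseˡ (u n)) , (λ u n → ℤ.+-inverseʳ (u n))
            ; ⁻¹-cong = λ p n → cong -_ (p n) }
          ; comm = λ u v n → ℤ.+-comm (u n) (v n) }
        ; *-cong = ⊛-cong
        ; *-assoc = ⊛-assoc
        ; *-identity = ⊛-identityˡ , ⊛-identityʳ
        ; distrib = ⊛-distribˡ , ⊛-distribʳ }
      ; *-comm = ⊛-comm } }

  const-homomorphism :
    CommutativeRing.rawRing ℤ.+-*-commutativeRing
      -Raw-AlmostCommutative⟶ fromCommutativeRing series-commutativeRing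
  const-homomorphism = record
    { ⟦_⟧    = const
    ; +-homo = λ { a b zero → refl ; a b (suc n) → refl }
    ; *-homo = λ { a b zero → refl ; a b (suc n) → sym (cong₂ _+_ (ℤ.*-zeroʳ a) (⊛-zeroˡ (const b) n)) }
    ; -‿homo = λ { a zero → refl ; a (suc n) → refl }
    ; 0-homo = λ { zero → refl ; (suc n) → refl }
    ; 1-homo = λ _ → refl }

  const-≟ : (a b : ℤ) → Maybe (const a ≋ const b)
  const-≟ a b with a ℤ.≟ b
  ... | yes refl = just (λ _ → refl)
  ... | no _     = nothing

  module SeriesSolver =
    Algebra.Solver.Ring (CommutativeRing.rawRing ℤ.+-*-commutativeRing)
      (fromCommutativeRing series-commutativeRing) const-homomorphism const-≟

  X⊛-suc : ∀ u n → (X ⊛ u) (suc n) ≡ u n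
  X⊛-suc u n = trans (ℤ.+-identityˡ _) (⊛-identityˡ u n)

  const⊛ : ∀ a u n → (const a ⊛ u) n ≡ a * u n
  const⊛ a u zero    = refl
  const⊛ a u (suc n) = trans (cong (a * u (suc n) +_) (⊛-zeroˡ u n)) (ℤ.+-identityʳ _)

module EulerOperator where

  open PowerSeries
  open import Data.Integer.Base using (+_; 1ℤ; _+_; _*_)
  import Data.Integer.Properties as ℤ
  open import Data.Integer.Tactic.RingSolver using (solve-∀)
  open import Data.Nat.Base using (zero; suc)
  open import Relation.Binary.PropositionalEquality

  θ : Series → Series
  θ u n = + n * u n

  θ-cong : ∀ {u v} → u ≋ v → θ u ≋ θ v
  θ-cong p n = cong (+ n *_) (p n)

  θ-⊕ : ∀ u v → θ (u ⊕ v) ≋ θ u ⊕ θ v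
  θ-⊕ u v n = ℤ.*-distribˡ-+ (+ n) (u n) (v n)

  θ-⊖ : ∀ u → θ (⊖ u) ≋ ⊖ θ u
  θ-⊖ u n = sym (ℤ.neg-distribʳ-* (+ n) (u n))

  θ-const : ∀ a → θ (const a) ≋ 𝟘
  θ-const a zero    = refl
  θ-const a (suc n) = ℤ.*-zeroʳ (+ suc n)

  θ-X : θ X ≋ X
  θ-X zero          = refl
  θ-X (suc zero)    = refl
  θ-X (suc (suc n)) = ℤ.*-zeroʳ (+ suc (suc n))

  tail-θ : ∀ u → tail (θ u) ≋ θ (tail u) ⊕ tail u
  tail-θ u n = suc-* (+ n) (u (suc n))
    where
    suc-* : ∀ m a → (1ℤ + m) * a ≡ m * a + a
    suc-* = solve-∀

  θ-⊛ : ∀ u v → θ (u ⊛ v) ≋ θ u ⊛ v ⊕ u ⊛ θ v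
  θ-⊛ u v zero    = sym (trans (ℤ.+-identityˡ _) (ℤ.*-zeroʳ (u 0)))
  θ-⊛ u v (suc n) = begin
    (1ℤ + + n) * (u 0 * v (suc n) + T)
      ≡⟨ expand (+ n) (u 0) (v (suc n)) T ⟩
    (+ n * T + T) + u 0 * ((1ℤ + + n) * v (suc n))
      ≡⟨ cong (λ z → (z + T) + u 0 * θ v (suc n)) (θ-⊛ (tail u) v n) ⟩
    ((θ (tail u) ⊛ v) n + (tail u ⊛ θ v) n + T) + u 0 * θ v (suc n)
      ≡⟨ regroup ((θ (tail u) ⊛ v) n) ((tail u ⊛ θ v) n) T (u 0 * θ v (suc n)) ⟩
    ((θ (tail u) ⊛ v) n + T) + (u 0 * θ v (suc n) + (tail u ⊛ θ v) n)
      ≡⟨ cong (_+ (u ⊛ θ v) (suc n)) (sym (⊛-distribʳ v (θ (tail u)) (tail u) n)) ⟩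
    ((θ (tail u) ⊕ tail u) ⊛ v) n + (u ⊛ θ v) (suc n)
      ≡⟨ cong (_+ (u ⊛ θ v) (suc n)) (sym (trans (ℤ.+-identityˡ _) (⊛-cong (tail-θ u) (λ _ → refl) n))) ⟩
    (θ u ⊛ v) (suc n) + (u ⊛ θ v) (suc n) ∎
    where
    open ≡-Reasoning
    T = (tail u ⊛ v) n
    expand : ∀ m a b t → (1ℤ + m) * (a * b + t) ≡ (m * t + t) + a * ((1ℤ + m) * b)
    expand = solve-∀
    regroup : ∀ p q t r → (p + q + t) + r ≡ (p + t) + (r + q)
    regroup = solve-∀

module CatalanSeries where

  open PowerSeries
  open EulerOperator
  open import Algebra.Bundles using (CommutativeRing)
  open import Data.Integer.Base using (+_)

  open CommutativeRing series-commutativeRing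
  open import Relation.Binary.Reasoning.Setoid setoid
  open SeriesSolver using (Polynomial; solve; _:=_; _:+_; _:-_; _:*_; :-_; con)

  two four : Series
  two  = const (+ 2)
  four = const (+ 4)

  ① ② ④ : ∀ {n} → Polynomial n
  ① = con (+ 1)
  ② = con (+ 2)
  ④ = con (+ 4)

  -- s = √(1 - 4X) and b = Σ (2n choose n) Xⁿ, once c is the Catalan series.
  module Identities (c : Series) (c-eq : c ≈ 1# + X * (c * c)) where

    s b : Series
    s = 1# - two * (X * c)
    b = c + θ c

    X*[c*c]≈c-1 : X * (c * c) ≈ c - 1#
    X*[c*c]≈c-1 = begin
      X * (c * c)              ≈⟨ solve 2 (λ x c → x :* (c :* c) := (① :+ x :* (c :* c)) :- ①) refl X c ⟩
      (1# + X * (c * c)) - 1#  ≈⟨ +-congʳ (sym c-eq) ⟩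
      c - 1#                   ∎

    θc-eq : θ c ≈ X * (c * c) + two * (X * (c * θ c))
    θc-eq = begin
      θ c                                            ≈⟨ θ-cong c-eq ⟩
      θ (1# + X * (c * c))                           ≈⟨ θ-⊕ 1# (X * (c * c)) ⟩
      θ 1# + θ (X * (c * c))                         ≈⟨ +-cong (θ-const _) (θ-⊛ X (c * c)) ⟩
      0# + (θ X * (c * c) + X * θ (c * c))           ≈⟨ +-congˡ {0#} (+-cong (*-congʳ {c * c} θ-X) (*-congˡ {X} (θ-⊛ c c))) ⟩
      0# + (X * (c * c) + X * (θ c * c + c * θ c))   ≈⟨ +-identityˡ _ ⟩
      X * (c * c) + X * (θ c * c + c * θ c)          ≈⟨ solve 3 (λ x c d → x :* (c :* c) :+ x :* (d :* c :+ c :* d)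
                                                                 := x :* (c :* c) :+ ② :* (x :* (c :* d))) refl X c (θ c) ⟩
      X * (c * c) + two * (X * (c * θ c))            ∎

    θc*s≈c-1 : θ c * s ≈ c - 1#
    θc*s≈c-1 = begin
      θ c * s
        ≈⟨ solve 3 (λ x c d → d :* (① :- ② :* (x :* c)) := d :- ② :* (x :* (c :* d))) refl X c (θ c) ⟩
      θ c - two * (X * (c * θ c))
        ≈⟨ +-congʳ θc-eq ⟩
      (X * (c * c) + two * (X * (c * θ c))) - two * (X * (c * θ c))
        ≈⟨ solve 3 (λ x c d → (x :* (c :* c) :+ ② :* (x :* (c :* d))) :- ② :* (x :* (c :* d)) := x :* (c :* c)) refl X c (θ c) ⟩
      X * (c * c)
        ≈⟨ X*[c*c]≈c-1 ⟩
      c - 1#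
        ∎

    c*s≈2-c : c * s ≈ two - c
    c*s≈2-c = begin
      c * s                    ≈⟨ solve 2 (λ x c → c :* (① :- ② :* (x :* c)) := c :- ② :* (x :* (c :* c))) refl X c ⟩
      c - two * (X * (c * c))  ≈⟨ +-congˡ {c} (-‿cong (*-congˡ {two} X*[c*c]≈c-1)) ⟩
      c - two * (c - 1#)       ≈⟨ solve 1 (λ c → c :- ② :* (c :- ①) := ② :- c) refl c ⟩
      two - c                  ∎

    b*s≈1 : b * s ≈ 1#
    b*s≈1 = begin
      b * s                    ≈⟨ distribʳ s c (θ c) ⟩
      c * s + θ c * s          ≈⟨ +-cong c*s≈2-c θc*s≈c-1 ⟩
      (two - c) + (c - 1#)     ≈⟨ solve 1 (λ c → (② :- c) :+ (c :- ①) := ①) refl c ⟩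
      1#                       ∎

    *s-cancelʳ : ∀ {u v} → u * s ≈ v * s → u ≈ v
    *s-cancelʳ {u} {v} us≈vs = begin
      u            ≈⟨ *-identityʳ u ⟨
      u * 1#       ≈⟨ *-congˡ b*s≈1 ⟨
      u * (b * s)  ≈⟨ solve 3 (λ u b s → u :* (b :* s) := (u :* s) :* b) refl u b s ⟩
      (u * s) * b  ≈⟨ *-congʳ us≈vs ⟩
      (v * s) * b  ≈⟨ solve 3 (λ v b s → (v :* s) :* b := v :* (b :* s)) refl v b s ⟩
      v * (b * s)  ≈⟨ *-congˡ b*s≈1 ⟩
      v * 1#       ≈⟨ *-identityʳ v ⟩
      v            ∎

    s*s≈1-4X : s * s ≈ 1# - four * X
    s*s≈1-4X = begin
      s * s
        ≈⟨ solve 2 (λ x c → (① :- ② :* (x :* c)) :* (① :- ② :* (x :* c)) := (① :- ④ :* (x :* c)) :+ ④ :* (x :* (x :* (c :* c))))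
                   refl X c ⟩
      (1# - four * (X * c)) + four * (X * (X * (c * c)))
        ≈⟨ +-congˡ {1# - four * (X * c)} (*-congˡ {four} (*-congˡ {X} X*[c*c]≈c-1)) ⟩
      (1# - four * (X * c)) + four * (X * (c - 1#))
        ≈⟨ solve 2 (λ x c → (① :- ④ :* (x :* c)) :+ ④ :* (x :* (c :- ①)) := ① :- ④ :* x) refl X c ⟩
      1# - four * X
        ∎

    θs≈-2Xb : θ s ≈ - (two * (X * b))
    θs≈-2Xb = begin
      θ (1# - two * (X * c))                         ≈⟨ θ-⊕ 1# (- (two * (X * c))) ⟩
      θ 1# + θ (- (two * (X * c)))                   ≈⟨ +-cong (θ-const _) (θ-⊖ (two * (X * c))) ⟩
      0# + - θ (two * (X * c))                       ≈⟨ +-identityˡ _ ⟩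
      - θ (two * (X * c))                            ≈⟨ -‿cong (θ-⊛ two (X * c)) ⟩
      - (θ two * (X * c) + two * θ (X * c))          ≈⟨ -‿cong (+-cong (*-congʳ {X * c} (θ-const _)) (*-congˡ {two} (θ-⊛ X c))) ⟩
      - (0# * (X * c) + two * (θ X * c + X * θ c))   ≈⟨ -‿cong (+-cong (zeroˡ (X * c)) (*-congˡ {two} (+-congʳ {X * θ c} (*-congʳ {c} θ-X)))) ⟩
      - (0# + two * (X * c + X * θ c))               ≈⟨ -‿cong (+-identityˡ _) ⟩
      - (two * (X * c + X * θ c))                    ≈⟨ -‿cong (*-congˡ {two} (distribˡ X c (θ c))) ⟨
      - (two * (X * b))                              ∎

    θb*s≈2Xb² : θ b * s ≈ two * (X * (b * b))
    θb*s≈2Xb² = begin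
      θ b * s                           ≈⟨ solve 3 (λ p b q → p := (p :+ b :* q) :- b :* q) refl (θ b * s) b (θ s) ⟩
      (θ b * s + b * θ s) - b * θ s     ≈⟨ +-congʳ (θ-⊛ b s) ⟨
      θ (b * s) - b * θ s               ≈⟨ +-congʳ (θ-cong b*s≈1) ⟩
      θ 1# - b * θ s                    ≈⟨ +-cong (θ-const _) (-‿cong (*-congˡ {b} θs≈-2Xb)) ⟩
      0# - b * - (two * (X * b))        ≈⟨ +-identityˡ _ ⟩
      - (b * - (two * (X * b)))         ≈⟨ solve 2 (λ x b → :- (b :* (:- (② :* (x :* b)))) := ② :* (x :* (b :* b))) refl X b ⟩
      two * (X * (b * b))               ∎

    b²≈1+4Xb² : b * b ≈ 1# + four * (X * (b * b))
    b²≈1+4Xb² = begin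
      b * b
        ≈⟨ solve 2 (λ x b → b :* b := (b :* b) :* (① :- ④ :* x) :+ ④ :* (x :* (b :* b))) refl X b ⟩
      (b * b) * (1# - four * X) + four * (X * (b * b))
        ≈⟨ +-congʳ (*-congˡ {b * b} s*s≈1-4X) ⟨
      (b * b) * (s * s) + four * (X * (b * b))
        ≈⟨ +-congʳ (solve 2 (λ b s → (b :* b) :* (s :* s) := (b :* s) :* (b :* s)) refl b s) ⟩
      (b * s) * (b * s) + four * (X * (b * b))
        ≈⟨ +-congʳ (*-cong b*s≈1 b*s≈1) ⟩
      1# * 1# + four * (X * (b * b))
        ≈⟨ +-congʳ (*-identityˡ 1#) ⟩
      1# + four * (X * (b * b))
        ∎

    θb≈X[4θb+2b] : θ b ≈ X * (four * θ b + two * b)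
    θb≈X[4θb+2b] = begin
      θ b
        ≈⟨ solve 2 (λ x p → p := p :* (① :- ④ :* x) :+ ④ :* (x :* p)) refl X (θ b) ⟩
      θ b * (1# - four * X) + four * (X * θ b)
        ≈⟨ +-congʳ (*-congˡ {θ b} s*s≈1-4X) ⟨
      θ b * (s * s) + four * (X * θ b)
        ≈⟨ +-congʳ (solve 2 (λ p s → p :* (s :* s) := (p :* s) :* s) refl (θ b) s) ⟩
      (θ b * s) * s + four * (X * θ b)
        ≈⟨ +-congʳ (*-congʳ {s} θb*s≈2Xb²) ⟩
      two * (X * (b * b)) * s + four * (X * θ b)
        ≈⟨ +-congʳ (solve 3 (λ x b s → ② :* (x :* (b :* b)) :* s := ② :* (x :* b) :* (b :* s)) refl X b s) ⟩
      two * (X * b) * (b * s) + four * (X * θ b)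
        ≈⟨ +-congʳ (*-congˡ {two * (X * b)} b*s≈1) ⟩
      two * (X * b) * 1# + four * (X * θ b)
        ≈⟨ solve 3 (λ x b p → ② :* (x :* b) :* ① :+ ④ :* (x :* p) := x :* (④ :* p :+ ② :* b)) refl X b (θ b) ⟩
      X * (four * θ b + two * b)
        ∎

    c*[b+1]≈2b : c * (b + 1#) ≈ two * b
    c*[b+1]≈2b = *s-cancelʳ (begin
      c * (b + 1#) * s           ≈⟨ solve 3 (λ c b s → c :* (b :+ ①) :* s := c :* (b :* s) :+ c :* s) refl c b s ⟩
      c * (b * s) + c * s        ≈⟨ +-cong (*-congˡ {c} b*s≈1) c*s≈2-c ⟩
      c * 1# + (two - c)         ≈⟨ solve 1 (λ c → c :* ① :+ (② :- c) := ② :* ①) refl c ⟩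
      two * 1#                   ≈⟨ *-congˡ {two} b*s≈1 ⟨
      two * (b * s)              ≈⟨ *-assoc two b s ⟨
      two * b * s                ∎)

    [b+1]*θc≈b²-b : (b + 1#) * θ c ≈ b * b - b
    [b+1]*θc≈b²-b = *s-cancelʳ (begin
      (b + 1#) * θ c * s         ≈⟨ *-assoc (b + 1#) (θ c) s ⟩
      (b + 1#) * (θ c * s)       ≈⟨ *-congˡ {b + 1#} θc*s≈c-1 ⟩
      (b + 1#) * (c - 1#)        ≈⟨ solve 2 (λ b c → (b :+ ①) :* (c :- ①) := c :* (b :+ ①) :- (b :+ ①)) refl b c ⟩
      c * (b + 1#) - (b + 1#)    ≈⟨ +-congʳ c*[b+1]≈2b ⟩
      two * b - (b + 1#)         ≈⟨ solve 1 (λ b → ② :* b :- (b :+ ①) := b :* ① :- ①) refl b ⟩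
      b * 1# - 1#                ≈⟨ +-cong (*-congˡ {b} b*s≈1) (-‿cong b*s≈1) ⟨
      b * (b * s) - b * s        ≈⟨ solve 2 (λ b s → b :* (b :* s) :- b :* s := (b :* b :- b) :* s) refl b s ⟩
      (b * b - b) * s            ∎)

    module _ (h : Series) (h-eq : h ≈ X * (two * (c * h) + b * θ c + θ c)) where

      2h≈θb-2Xb² : two * h ≈ θ b - two * (X * (b * b))
      2h≈θb-2Xb² = *s-cancelʳ (begin
        two * h * s
          ≈⟨ solve 3 (λ x c h → ② :* h :* (① :- ② :* (x :* c)) := ② :* (h :- ② :* (x :* (c :* h)))) refl X c h ⟩
        two * (h - two * (X * (c * h)))
          ≈⟨ *-congˡ {two} (+-congʳ h-eq) ⟩
        two * (X * (two * (c * h) + b * θ c + θ c) - two * (X * (c * h)))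
          ≈⟨ solve 5 (λ x c h b d → ② :* (x :* (② :* (c :* h) :+ b :* d :+ d) :- ② :* (x :* (c :* h)))
                                  := ② :* (x :* ((b :+ ①) :* d))) refl X c h b (θ c) ⟩
        two * (X * ((b + 1#) * θ c))
          ≈⟨ *-congˡ {two} (*-congˡ {X} [b+1]*θc≈b²-b) ⟩
        two * (X * (b * b - b))
          ≈⟨ solve 2 (λ x b → ② :* (x :* (b :* b :- b)) := ② :* (x :* (b :* b)) :- ② :* (x :* b) :* ①) refl X b ⟩
        two * (X * (b * b)) - two * (X * b) * 1#
          ≈⟨ +-cong θb*s≈2Xb² (-‿cong (*-congˡ {two * (X * b)} b*s≈1)) ⟨
        θ b * s - two * (X * b) * (b * s)
          ≈⟨ solve 4 (λ p x b s → p :* s :- ② :* (x :* b) :* (b :* s) := (p :- ② :* (x :* (b :* b))) :* s) refl (θ b) X b s ⟩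
        (θ b - two * (X * (b * b))) * s
          ∎)

module CentralBinomial where

  open import Data.Nat.Base
  open import Data.Nat.Combinatorics
  open import Data.Nat.Properties
  open import Data.Nat.Tactic.RingSolver using (solve-∀)
  open import Relation.Binary.PropositionalEquality
  open ≡-Reasoning

  [k+1]*[n+1]C[k+1]≡[n+1]*nCk : ∀ n k → suc k * (suc n C suc k) ≡ suc n * (n C k)
  [k+1]*[n+1]C[k+1]≡[n+1]*nCk zero zero    = refl
  [k+1]*[n+1]C[k+1]≡[n+1]*nCk zero (suc k) = trans (cong ((2 + k) *_) (k>n⇒nCk≡0 {1} {2 + k} (s≤s (s≤s z≤n)))) (*-zeroʳ (2 + k))
  [k+1]*[n+1]C[k+1]≡[n+1]*nCk (suc n) zero = begin
    1 * ((2 + n) C 1)   ≡⟨ *-identityˡ _ ⟩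
    (2 + n) C 1       ≡⟨ nC1≡n (2 + n) ⟩
    2 + n             ≡⟨ *-identityʳ (2 + n) ⟨
    (2 + n) * 1       ∎
  [k+1]*[n+1]C[k+1]≡[n+1]*nCk (suc n) (suc k) = begin
    (2 + k) * ((2 + n) C (2 + k))
      ≡⟨ cong ((2 + k) *_) (nCk+nC[k+1]≡[n+1]C[k+1] (suc n) (suc k)) ⟨
    (2 + k) * (suc n C suc k + suc n C (2 + k))
      ≡⟨ split (suc n C suc k) (suc n C (2 + k)) k ⟩
    (suc k * (suc n C suc k) + (2 + k) * (suc n C (2 + k))) + suc n C suc k
      ≡⟨ cong₂ (λ a b → (a + b) + suc n C suc k) ([k+1]*[n+1]C[k+1]≡[n+1]*nCk n k) ([k+1]*[n+1]C[k+1]≡[n+1]*nCk n (suc k)) ⟩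
    (suc n * (n C k) + suc n * (n C suc k)) + suc n C suc k
      ≡⟨ cong (_+ suc n C suc k) (*-distribˡ-+ (suc n) (n C k) (n C suc k)) ⟨
    suc n * (n C k + n C suc k) + suc n C suc k
      ≡⟨ cong (λ z → suc n * z + suc n C suc k) (nCk+nC[k+1]≡[n+1]C[k+1] n k) ⟩
    suc n * (suc n C suc k) + suc n C suc k
      ≡⟨ +-comm (suc n * (suc n C suc k)) (suc n C suc k) ⟩
    (2 + n) * (suc n C suc k) ∎
    where
    split : ∀ a b k → (2 + k) * (a + b) ≡ (suc k * a + (2 + k) * b) + a
    split = solve-∀

  centralBinomial : ℕ → ℕ
  centralBinomial n = (2 * n) C n

  [n+1]*centralBinomial[n+1] : ∀ n → suc n * centralBinomial (suc n) ≡ 4 * (n * centralBinomial n) + 2 * centralBinomial n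
  [n+1]*centralBinomial[n+1] n = *-cancelˡ-≡ _ _ (suc n) (begin
    suc n * (suc n * ((2 * suc n) C suc n))
      ≡⟨ cong (λ m → suc n * (suc n * (m C suc n))) (*-suc 2 n) ⟩
    suc n * (suc n * (suc (suc (2 * n)) C suc n))
      ≡⟨ cong (suc n *_) ([k+1]*[n+1]C[k+1]≡[n+1]*nCk (suc (2 * n)) n) ⟩
    suc n * (suc (suc (2 * n)) * (suc (2 * n) C n))
      ≡⟨ exchange (suc n) (suc (suc (2 * n))) (suc (2 * n) C n) ⟩
    suc (suc (2 * n)) * (suc n * (suc (2 * n) C n))
      ≡⟨ cong (λ z → suc (suc (2 * n)) * (suc n * z)) symmetric ⟩
    suc (suc (2 * n)) * (suc n * (suc (2 * n) C suc n))
      ≡⟨ cong (suc (suc (2 * n)) *_) ([k+1]*[n+1]C[k+1]≡[n+1]*nCk (2 * n) n) ⟩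
    suc (suc (2 * n)) * (suc (2 * n) * centralBinomial n)
      ≡⟨ regroup n (centralBinomial n) ⟩
    suc n * (4 * (n * centralBinomial n) + 2 * centralBinomial n) ∎)
    where
    regroup : ∀ n a → suc (suc (2 * n)) * (suc (2 * n) * a) ≡ suc n * (4 * (n * a) + 2 * a)
    regroup = solve-∀
    exchange : ∀ a b c → a * (b * c) ≡ b * (a * c)
    exchange = solve-∀
    [2n+1]∸n≡n+1 : suc (2 * n) ∸ n ≡ suc n
    [2n+1]∸n≡n+1 = trans (cong (_∸ n) (2n+1≡n+[n+1] n)) (m+n∸m≡n n (suc n))
      where
      2n+1≡n+[n+1] : ∀ n → suc (2 * n) ≡ n + suc n
      2n+1≡n+[n+1] = solve-∀
    symmetric : suc (2 * n) C n ≡ suc (2 * n) C suc n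
    symmetric = trans (nCk≡nC[n∸k] (m≤n⇒m≤1+n (m≤m+n n (n + 0)))) (cong (suc (2 * n) C_) [2n+1]∸n≡n+1)

module ClosedForm where

  open HorizontalEdges using (glueGain)
  open AntidiagonalSum
  open PowerSeries
  open EulerOperator
  open CatalanSeries
  open CentralBinomial
  import Data.Integer.Base as ℤ
  import Data.Integer.Properties as ℤ
  import Data.Integer.Tactic.RingSolver as ℤ
  open import Data.Nat.Base
  open import Data.Nat.DivMod using (m*n/n≡m)
  open import Data.Nat.Properties using (*-comm; +-identityʳ; m+n∸n≡m)
  open import Data.Nat.Tactic.RingSolver using (solve-∀)
  open import Relation.Binary.PropositionalEquality
  open ≡-Reasoning

  toSeries : (ℕ → ℕ) → Series
  toSeries u n = ℤ.+ u n

  antidiagonalSum-⊛ : ∀ u v n → ℤ.+ antidiagonalSum (λ k m → u k * v m) n ≡ (toSeries u ⊛ toSeries v) n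
  antidiagonalSum-⊛ u v zero    = trans (cong ℤ.+_ (+-identityʳ _)) (ℤ.pos-* (u 0) (v 0))
  antidiagonalSum-⊛ u v (suc n) = begin
    ℤ.+ antidiagonalSum (λ k m → u k * v m) (suc n)
      ≡⟨ cong ℤ.+_ (antidiagonalSum-suc (λ k m → u k * v m) n) ⟩
    ℤ.+ (u 0 * v (suc n) + antidiagonalSum (λ k m → u (suc k) * v m) n)
      ≡⟨ ℤ.pos-+ (u 0 * v (suc n)) _ ⟩
    ℤ.+ (u 0 * v (suc n)) ℤ.+ ℤ.+ antidiagonalSum (λ k m → u (suc k) * v m) n
      ≡⟨ cong₂ ℤ._+_ (ℤ.pos-* (u 0) (v (suc n))) (antidiagonalSum-⊛ (λ k → u (suc k)) v n) ⟩
    (toSeries u ⊛ toSeries v) (suc n) ∎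

  module _ (c h : ℕ → ℕ)
    (c-zero : c 0 ≡ 1)
    (c-suc  : ∀ n → c (suc n) ≡ antidiagonalSum (λ k m → c m * c k) n)
    (h-zero : h 0 ≡ 0)
    (h-suc  : ∀ n → h (suc n) ≡ antidiagonalSum (λ k m → h m * c k + c m * h k + c m * c k * glueGain k m) n)
    where

    ĉ ĥ : Series
    ĉ = toSeries c
    ĥ = toSeries h

    ĉ-eq : ĉ ≋ 𝟙 ⊕ X ⊛ (ĉ ⊛ ĉ)
    ĉ-eq zero    = cong ℤ.+_ c-zero
    ĉ-eq (suc n) = begin
      ℤ.+ c (suc n)                                      ≡⟨ cong ℤ.+_ (c-suc n) ⟩
      ℤ.+ antidiagonalSum (λ k m → c m * c k) n          ≡⟨ cong ℤ.+_ (antidiagonalSum-cong (λ k m → *-comm (c m) (c k)) n) ⟩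
      ℤ.+ antidiagonalSum (λ k m → c k * c m) n          ≡⟨ antidiagonalSum-⊛ c c n ⟩
      (ĉ ⊛ ĉ) n                                          ≡⟨ trans (ℤ.+-identityˡ _) (X⊛-suc (ĉ ⊛ ĉ) n) ⟨
      (𝟙 ⊕ X ⊛ (ĉ ⊛ ĉ)) (suc n)                          ∎

    open CatalanSeries.Identities ĉ ĉ-eq using (b; θb≈X[4θb+2b]; b²≈1+4Xb²; 2h≈θb-2Xb²)

    -- glueGain k m = (k + 1) m + [m = 0] k, so the gluing term has generating function b θc + θc.
    glueGain-split : ∀ k m → c m * c k * glueGain k m ≡ (suc k * c k) * (m * c m) + atZero m (k * c k)
    glueGain-split k zero    rewrite c-zero = split₀ k (c k)
      where
      split₀ : ∀ k a → 1 * a * k ≡ suc k * a * (0 * 1) + k * a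
      split₀ = solve-∀
    glueGain-split k (suc m) = split₊ m k (c (suc m)) (c k)
      where
      split₊ : ∀ m k a b → a * b * (suc m * suc k) ≡ suc k * b * (suc m * a) + 0
      split₊ = solve-∀

    toSeries-[k+1]*c : toSeries (λ k → suc k * c k) ≋ b
    toSeries-[k+1]*c k = trans (ℤ.pos-+ (c k) (k * c k)) (cong (λ z → ĉ k ℤ.+ z) (ℤ.pos-* k (c k)))

    toSeries-k*c : toSeries (λ k → k * c k) ≋ θ ĉ
    toSeries-k*c k = ℤ.pos-* k (c k)

    h-suc-split : ∀ n → h (suc n) ≡ (antidiagonalSum (λ k m → c k * h m) n + antidiagonalSum (λ k m → h k * c m) n)
                                   + (antidiagonalSum (λ k m → (suc k * c k) * (m * c m)) n + n * c n)
    h-suc-split n = begin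
      h (suc n)
        ≡⟨ h-suc n ⟩
      antidiagonalSum (λ k m → h m * c k + c m * h k + c m * c k * glueGain k m) n
        ≡⟨ antidiagonalSum-cong (λ k m → cong₂ _+_ (cong₂ _+_ (*-comm (h m) (c k)) (*-comm (c m) (h k))) (glueGain-split k m)) n ⟩
      antidiagonalSum (λ k m → (c k * h m + h k * c m) + ((suc k * c k) * (m * c m) + atZero m (k * c k))) n
        ≡⟨ antidiagonalSum-+ (λ k m → c k * h m + h k * c m) (λ k m → (suc k * c k) * (m * c m) + atZero m (k * c k)) n ⟩
      antidiagonalSum (λ k m → c k * h m + h k * c m) n + antidiagonalSum (λ k m → (suc k * c k) * (m * c m) + atZero m (k * c k)) n
        ≡⟨ cong₂ _+_ (antidiagonalSum-+ (λ k m → c k * h m) (λ k m → h k * c m) n)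
                     (trans (antidiagonalSum-+ (λ k m → (suc k * c k) * (m * c m)) (λ k m → atZero m (k * c k)) n)
                            (cong (antidiagonalSum (λ k m → (suc k * c k) * (m * c m)) n +_) (antidiagonalSum-atZero (λ k → k * c k) n))) ⟩
      (antidiagonalSum (λ k m → c k * h m) n + antidiagonalSum (λ k m → h k * c m) n)
        + (antidiagonalSum (λ k m → (suc k * c k) * (m * c m)) n + n * c n) ∎

    ĥ-eq : ĥ ≋ X ⊛ (two ⊛ (ĉ ⊛ ĥ) ⊕ b ⊛ θ ĉ ⊕ θ ĉ)
    ĥ-eq zero    = cong ℤ.+_ h-zero
    ĥ-eq (suc n) = begin
      ℤ.+ h (suc n)
        ≡⟨ cong ℤ.+_ (h-suc-split n) ⟩
      ℤ.+ ((A + B) + (D + n * c n))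
        ≡⟨ trans (ℤ.pos-+ (A + B) _) (cong₂ ℤ._+_ (ℤ.pos-+ A B) (ℤ.pos-+ D _)) ⟩
      (ℤ.+ A ℤ.+ ℤ.+ B) ℤ.+ (ℤ.+ D ℤ.+ ℤ.+ (n * c n))
        ≡⟨ cong₂ ℤ._+_ (cong₂ ℤ._+_ (antidiagonalSum-⊛ c h n) (trans (antidiagonalSum-⊛ h c n) (⊛-comm ĥ ĉ n)))
                       (cong₂ ℤ._+_ (trans (antidiagonalSum-⊛ (λ k → suc k * c k) (λ m → m * c m) n) (⊛-cong toSeries-[k+1]*c toSeries-k*c n))
                                    (toSeries-k*c n)) ⟩
      ((ĉ ⊛ ĥ) n ℤ.+ (ĉ ⊛ ĥ) n) ℤ.+ ((b ⊛ θ ĉ) n ℤ.+ θ ĉ n)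
        ≡⟨ double ((ĉ ⊛ ĥ) n) ((b ⊛ θ ĉ) n) (θ ĉ n) ⟩
      (ℤ.+ 2 ℤ.* (ĉ ⊛ ĥ) n ℤ.+ (b ⊛ θ ĉ) n) ℤ.+ θ ĉ n
        ≡⟨ cong (λ z → (z ℤ.+ (b ⊛ θ ĉ) n) ℤ.+ θ ĉ n) (const⊛ (ℤ.+ 2) (ĉ ⊛ ĥ) n) ⟨
      (two ⊛ (ĉ ⊛ ĥ) ⊕ b ⊛ θ ĉ ⊕ θ ĉ) n
        ≡⟨ X⊛-suc _ n ⟨
      (X ⊛ (two ⊛ (ĉ ⊛ ĥ) ⊕ b ⊛ θ ĉ ⊕ θ ĉ)) (suc n) ∎
      where
      A = antidiagonalSum (λ k m → c k * h m) n
      B = antidiagonalSum (λ k m → h k * c m) n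
      D = antidiagonalSum (λ k m → (suc k * c k) * (m * c m)) n
      double : ∀ p q r → (p ℤ.+ p) ℤ.+ (q ℤ.+ r) ≡ (ℤ.+ 2 ℤ.* p ℤ.+ q) ℤ.+ r
      double = ℤ.solve-∀

    b≡centralBinomial : ∀ n → b n ≡ ℤ.+ centralBinomial n
    b≡centralBinomial zero    = trans (ℤ.+-identityʳ (ĉ 0)) (cong ℤ.+_ c-zero)
    b≡centralBinomial (suc n) = ℤ.*-cancelˡ-≡ (ℤ.+ suc n) (b (suc n)) (ℤ.+ centralBinomial (suc n)) (begin
      θ b (suc n)                                                     ≡⟨ θb≈X[4θb+2b] (suc n) ⟩
      (X ⊛ (four ⊛ θ b ⊕ two ⊛ b)) (suc n)                            ≡⟨ X⊛-suc _ n ⟩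
      (four ⊛ θ b) n ℤ.+ (two ⊛ b) n                                  ≡⟨ cong₂ ℤ._+_ (const⊛ (ℤ.+ 4) (θ b) n) (const⊛ (ℤ.+ 2) b n) ⟩
      ℤ.+ 4 ℤ.* (ℤ.+ n ℤ.* b n) ℤ.+ ℤ.+ 2 ℤ.* b n                     ≡⟨ cong (λ z → ℤ.+ 4 ℤ.* (ℤ.+ n ℤ.* z) ℤ.+ ℤ.+ 2 ℤ.* z) (b≡centralBinomial n) ⟩
      ℤ.+ 4 ℤ.* (ℤ.+ n ℤ.* ℤ.+ B) ℤ.+ ℤ.+ 2 ℤ.* ℤ.+ B                 ≡⟨ cong₂ ℤ._+_ (trans (ℤ.pos-* 4 (n * B)) (cong (ℤ.+ 4 ℤ.*_) (ℤ.pos-* n B))) (ℤ.pos-* 2 B) ⟨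
      ℤ.+ (4 * (n * B)) ℤ.+ ℤ.+ (2 * B)                               ≡⟨ ℤ.pos-+ (4 * (n * B)) (2 * B) ⟨
      ℤ.+ (4 * (n * B) + 2 * B)                                       ≡⟨ cong ℤ.+_ ([n+1]*centralBinomial[n+1] n) ⟨
      ℤ.+ (suc n * centralBinomial (suc n))                           ≡⟨ ℤ.pos-* (suc n) (centralBinomial (suc n)) ⟩
      ℤ.+ suc n ℤ.* ℤ.+ centralBinomial (suc n)                       ∎)
      where B = centralBinomial n

    b*b≡4^ : ∀ n → (b ⊛ b) n ≡ ℤ.+ (4 ^ n)
    b*b≡4^ zero    = b²≈1+4Xb² 0
    b*b≡4^ (suc n) = begin
      (b ⊛ b) (suc n)                             ≡⟨ b²≈1+4Xb² (suc n) ⟩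
      ℤ.0ℤ ℤ.+ (four ⊛ (X ⊛ (b ⊛ b))) (suc n)       ≡⟨ ℤ.+-identityˡ _ ⟩
      (four ⊛ (X ⊛ (b ⊛ b))) (suc n)              ≡⟨ const⊛ (ℤ.+ 4) (X ⊛ (b ⊛ b)) (suc n) ⟩
      ℤ.+ 4 ℤ.* (X ⊛ (b ⊛ b)) (suc n)             ≡⟨ cong (ℤ.+ 4 ℤ.*_) (trans (X⊛-suc (b ⊛ b) n) (b*b≡4^ n)) ⟩
      ℤ.+ 4 ℤ.* ℤ.+ (4 ^ n)                       ≡⟨ ℤ.pos-* 4 (4 ^ n) ⟨
      ℤ.+ (4 ^ suc n)                             ∎

    2h[n+1]+2*4^n : ∀ n → 2 * h (suc n) + 2 * 4 ^ n ≡ suc n * centralBinomial (suc n)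
    2h[n+1]+2*4^n n = ℤ.+-injective (begin
      ℤ.+ (2 * h (suc n) + 2 * 4 ^ n)
        ≡⟨ trans (ℤ.pos-+ (2 * h (suc n)) _) (cong₂ ℤ._+_ (trans (ℤ.pos-* 2 (h (suc n))) (sym (const⊛ (ℤ.+ 2) ĥ (suc n)))) (ℤ.pos-* 2 (4 ^ n))) ⟩
      (two ⊛ ĥ) (suc n) ℤ.+ ℤ.+ 2 ℤ.* ℤ.+ (4 ^ n)
        ≡⟨ cong₂ ℤ._+_ (2h≈θb-2Xb² ĥ ĥ-eq (suc n)) (cong (ℤ.+ 2 ℤ.*_) (sym (b*b≡4^ n))) ⟩
      (θ b (suc n) ℤ.- (two ⊛ (X ⊛ (b ⊛ b))) (suc n)) ℤ.+ ℤ.+ 2 ℤ.* (b ⊛ b) n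
        ≡⟨ cong (λ z → (θ b (suc n) ℤ.- z) ℤ.+ ℤ.+ 2 ℤ.* (b ⊛ b) n)
                (trans (const⊛ (ℤ.+ 2) (X ⊛ (b ⊛ b)) (suc n)) (cong (ℤ.+ 2 ℤ.*_) (X⊛-suc (b ⊛ b) n))) ⟩
      (θ b (suc n) ℤ.- ℤ.+ 2 ℤ.* (b ⊛ b) n) ℤ.+ ℤ.+ 2 ℤ.* (b ⊛ b) n
        ≡⟨ minus-plus (θ b (suc n)) (ℤ.+ 2 ℤ.* (b ⊛ b) n) ⟩
      θ b (suc n)
        ≡⟨ cong (ℤ.+ suc n ℤ.*_) (b≡centralBinomial (suc n)) ⟩
      ℤ.+ suc n ℤ.* ℤ.+ centralBinomial (suc n)
        ≡⟨ ℤ.pos-* (suc n) (centralBinomial (suc n)) ⟨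
      ℤ.+ (suc n * centralBinomial (suc n)) ∎)
      where
      minus-plus : ∀ p q → (p ℤ.- q) ℤ.+ q ≡ p
      minus-plus = ℤ.solve-∀

    h-closed-form : ∀ n → h (suc n) ≡ (suc n * centralBinomial (suc n)) / 2 ∸ 4 ^ n
    h-closed-form n = sym (begin
      (suc n * centralBinomial (suc n)) / 2 ∸ 4 ^ n  ≡⟨ cong (λ m → m / 2 ∸ 4 ^ n) (2h[n+1]+2*4^n n) ⟨
      (2 * h (suc n) + 2 * 4 ^ n) / 2 ∸ 4 ^ n        ≡⟨ cong (λ m → m / 2 ∸ 4 ^ n) (factor (h (suc n)) (4 ^ n)) ⟩
      ((h (suc n) + 4 ^ n) * 2) / 2 ∸ 4 ^ n          ≡⟨ cong (_∸ 4 ^ n) (m*n/n≡m (h (suc n) + 4 ^ n) 2) ⟩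
      (h (suc n) + 4 ^ n) ∸ 4 ^ n                    ≡⟨ m+n∸n≡m (h (suc n)) (4 ^ n) ⟩
      h (suc n)                                      ∎)
      where
      factor : ∀ a p → 2 * a + 2 * p ≡ (a + p) * 2
      factor = solve-∀

open import Defs
open Recurrences
open ClosedForm
open import Data.Nat using (ℕ; suc; _*_; _∸_; _^_; _/_)
open import Data.Nat.Combinatorics using (_C_)
open import Relation.Binary.PropositionalEquality using (_≡_; refl)

theorem4p3 : (n : ℕ) → 1 Data.Nat.≤ n →
    Hsum n ≡ (n * ((2 * n) C n)) / 2 ∸ 4 ^ (n ∸ 1)
theorem4p3 (suc n) _ = h-closed-form #Av213 Hsum refl #Av213-suc refl Hsum-suc n
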